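{- Let $k\ge 1$. Let $\mathcal{H}$ be the bi-hypergraph obtained from $\mathcal{H}_{2k}$ by adding two new vertices $u$ and $v$, removing the edge $\{v_{1,1},v_{1,2},v_{1,3}\}$, and adding the edges $\{u,v_{1,1},v_{1,2}\}$, $\{v,v_{1,2},v_{1,3}\}$, and, for all $j\in\{1,2\}$, the edges $\{u,v_{1,j},v_{2k,3-j}\}$ and $\{v,v_{1,j+1},v_{2k,4-j}\}$. Then $\mathcal{H}$ is minimal uncolorable.
   Context: A bi-hypergraph is a pair $(\mathcal{V},\mathcal{E})$ with $\mathcal{V}$ a finite set and $\mathcal{E}$ a family of subsets of $\mathcal{V}$ (edges). A proper coloring is a map $f:\mathcal{V}\to\mathbb{N}$ with $1<|\{f(x):x\in e\}|<|e|$ for every edge $e$; a bi-hypergraph is colorable if such $f$ exists. A subhypergraph is $(\mathcal{V}',\mathcal{E}')$ with $\mathcal{V}'\subseteq\mathcal{V}$, $\mathcal{E}'\subseteq\mathcal{E}$; a bi-hypergraph is minimal uncolorable if it is uncolorable but each of its proper subhypergraphs is colorable. For $k\ge 2$, let $V_i=\{v_{i,1},v_{i,2},v_{i,3}\}$ ($i\in[k]$) be pairwise disjoint sets, and write $v_{i,4}=v_{i,1}$, $v_{i,5}=v_{i,2}$. The bi-hypergraph $\mathcal{H}_k$ has vertex set $V_1\cup\cdots\cup V_k$ and edge set consisting of the edges $V_i$ for all $i\in[k]$, together with the edges $\{v_{q+1,j},v_{q,j},v_{q,j+t}\}$ for all $q\in[k-1]$, $j\in\{1,2,3\}$, $t\in\{1,2\}$.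 -}

module Defs where

open import Data.Nat using (ℕ; zero; suc; _+_; _*_; _∸_; _<_)
open import Data.Nat.Properties using (_≟_)
open import Data.Fin using (Fin; toℕ)
open import Data.Fin.Subset using (Subset; _∈_; _⊆_; ⊤; ∣_∣)
open import Data.Fin.Subset.Properties using (_∈?_)
open import Data.List using (List; []; _∷_; map; filter; length; deduplicate; allFin; concatMap; upTo)
open import Data.Bool.ListAction using (any)
open import Data.Vec using (tabulate)
open import Data.Bool using (Bool)
open import Data.Nat using (_≡ᵇ_)
open import Data.Product using (Σ; _×_; _,_)
open import Relation.Binary.PropositionalEquality using (_≡_)
open import Relation.Nullary using (¬_)

-- A bi-hypergraph has vertex set Fin n (all of it) and a finite family of
-- m edges, edge i being a subset of Fin n (families may in principle
-- repeat subsets, as edges are indexed by Fin m).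

record BiHypergraph : Set where
  field
    nV    : ℕ
    nE    : ℕ
    edge  : Fin nE → Subset nV
open BiHypergraph public

members : ∀ {n} → Subset n → List (Fin n)
members e = filter (_∈? e) (allFin _)

numColors : ∀ {n} → (Fin n → ℕ) → Subset n → ℕ
numColors f e = length (deduplicate _≟_ (map f (members e)))

ProperOn : ∀ {n} → (Fin n → ℕ) → Subset n → Set
ProperOn f e = (1 < numColors f e) × (numColors f e < ∣ e ∣)

-- A subhypergraph (V', E') of H: V' ⊆ V (automatic, V = Fin n),
-- E' ⊆ E, and every chosen edge lies inside V' (so that it is a
-- bi-hypergraph).
IsSub : (H : BiHypergraph) → Subset (nV H) → Subset (nE H) → Set
IsSub H V' E' = ∀ i → i ∈ E' → edge H i ⊆ V'

-- The subhypergraph (V', E') is colorable: there is f : V' → ℕ proper on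
-- every edge in E'.  (Colors outside V' are irrelevant since all edges
-- of E' lie in V'.)
ColorableSub : (H : BiHypergraph) → Subset (nV H) → Subset (nE H) → Set
ColorableSub H V' E' =
  Σ (Fin (nV H) → ℕ) λ f → ∀ i → i ∈ E' → ProperOn f (edge H i)

Colorable : BiHypergraph → Set
Colorable H = ColorableSub H ⊤ ⊤

MinimalUncolorable : BiHypergraph → Set
MinimalUncolorable H =
  (¬ Colorable H) ×
  (∀ (V' : Subset (nV H)) (E' : Subset (nE H)) → IsSub H V' E' →
     ¬ (V' ≡ ⊤ × E' ≡ ⊤) → ColorableSub H V' E')

toSubset : (n : ℕ) → List ℕ → Subset n
toSubset n xs = tabulate λ (x : Fin n) → any (λ y → toℕ x ≡ᵇ y) xs

fromLists : (n : ℕ) → List (List ℕ) → BiHypergraph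
fromLists n es = record
  { nV = n ; nE = length es
  ; edge = λ i → toSubset n (Data.List.lookup es i) }

-- [ a ⋯ b ] = the list a, a+1, ..., b  (empty if b < a)
[_⋯_] : ℕ → ℕ → List ℕ
[ a ⋯ b ] = map (a +_) (upTo (suc b ∸ a))

-- The bi-hypergraph of Lemma 4.5.
-- Vertex numbering: u = 0, v = 1, and v_{i,j} = 3i + j - 2 for
-- i ∈ [2k], j ∈ {1,2,3}  (so v_{1,1} = 2, ..., v_{2k,3} = 6k + 1);
-- total 6k + 2 vertices.  Indices j ∈ {4,5} wrap: v_{i,4} = v_{i,1},
-- v_{i,5} = v_{i,2}.

uV vV : ℕ
uV = 0
vV = 1

wrap : ℕ → ℕ
wrap 4 = 1
wrap 5 = 2
wrap j = j

vtx : ℕ → ℕ → ℕ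
vtx i j = 3 * i + wrap j ∸ 2

HKEdgesNoV1 : ℕ → List (List ℕ)
HKEdgesNoV1 K =
  map (λ i → vtx i 1 ∷ vtx i 2 ∷ vtx i 3 ∷ []) [ 2 ⋯ K ]
  Data.List.++
  concatMap (λ q → concatMap (λ j → map (λ t →
      vtx (suc q) j ∷ vtx q j ∷ vtx q (j + t) ∷ [])
    [ 1 ⋯ 2 ]) [ 1 ⋯ 3 ]) [ 1 ⋯ K ∸ 1 ]

newEdges : ℕ → List (List ℕ)
newEdges K =
  (uV ∷ vtx 1 1 ∷ vtx 1 2 ∷ []) ∷
  (vV ∷ vtx 1 2 ∷ vtx 1 3 ∷ []) ∷
  concatMap (λ j →
      (uV ∷ vtx 1 j ∷ vtx K (3 ∸ j) ∷ []) ∷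
      (vV ∷ vtx 1 (j + 1) ∷ vtx K (4 ∸ j) ∷ []) ∷ [])
    [ 1 ⋯ 2 ]

Hlemma : ℕ → BiHypergraph
Hlemma k = fromLists (2 + 3 * (2 * k))
  (HKEdgesNoV1 (2 * k) Data.List.++ newEdges (2 * k))

module Submission where

-- A proper colouring gives every edge of H exactly two colours.  The six edges between
-- consecutive layers force a layer coloured (a, a, b) to be followed by one coloured (b, b, a)
-- (up to the symmetries of the pattern), so two-coloured layers repeat with period two and V_{2k}
-- is coloured like V_2.  The edges between V_1 and V_2 together with the six edges through u and v
-- then leave no possible colouring of V_1: it can be neither constant, nor two-coloured, nor
-- rainbow.
--
-- For minimality it suffices to colour H with one edge removed, since every vertex lies on an
-- edge.  Such a colouring alternates two patterns along the layers, with a defect at the layer of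
-- the removed edge; the finitely many patterns needed are certified by evaluation.

open import Defs
open import Function using (_∘_; id; const)
open import Function.Bundles using (_⇔_; mk⇔; Equivalence; mk↣)
open import Function.Construct.Composition using (_⇔-∘_)
open import Data.Nat using (ℕ; zero; suc; pred; _+_; _*_; _∸_; _<_; _≤_; z≤n; s≤s; _≡ᵇ_; _<?_)
open import Data.Nat.Properties
open import Data.Bool using (Bool; true; false; not; T; if_then_else_; _∨_)
open import Data.Bool.Properties using (T-≡; not-involutive)
open import Data.Bool.ListAction using (any)
open import Data.Unit using (⊤; tt)
open import Data.Empty using (⊥; ⊥-elim)
open import Data.Product using (_×_; _,_; ∃-syntax; ∃₂)
open import Data.Sum using (_⊎_; inj₁; inj₂)
open import Data.Fin using (Fin; toℕ; fromℕ<) renaming (zero to fzero; suc to fsuc)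
open import Data.Fin.Properties using (toℕ<n; fromℕ<-toℕ; any?)
open import Data.Fin.Subset as Subset using (Subset; ∣_∣; _⊆_)
open import Data.Fin.Subset.Properties using (_∈?_; ⊆⊤; ⊆-antisym; ∈⊤)
open import Data.Vec as Vec using (tabulate)
open import Data.Vec.Properties using (lookup∘tabulate; lookup⇒[]=)
open import Data.List
  using (List; []; _∷_; _++_; map; filter; length; deduplicate; allFin; concatMap; upTo; lookup)
import Data.List as List
open import Data.List.Properties
  using (≡-dec; map-cong; map-∘; map-++; map-tabulate; concatMap-map; map-concatMap)
open import Data.List.Relation.Unary.All as All using (All; []; _∷_)
import Data.List.Relation.Unary.All.Properties as All
open import Data.List.Relation.Unary.AllPairs using (AllPairs; []; _∷_)
import Data.List.Relation.Unary.AllPairs as AllPairs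
import Data.List.Relation.Unary.AllPairs.Properties as AllPairs
import Data.List.Relation.Unary.Any as Any
open import Data.List.Relation.Unary.Any using (here; there)
open import Data.List.Relation.Unary.Any.Properties using (any⇔; lookup-index)
open import Data.List.Membership.Propositional using (_∈_; find; lose)
open import Data.List.Membership.Propositional.Properties
  using (∈-map⁺; ∈-map⁻; ∈-++⁺ˡ; ∈-++⁺ʳ; ∈-++⁻; ∈-concatMap⁺; ∈-concatMap⁻; ∈-upTo⁺; ∈-upTo⁻; ∈-lookup)
open import Data.List.Relation.Unary.Unique.Propositional using (Unique)
open import Data.List.Relation.Unary.Unique.Propositional.Properties using (map⁺; ++⁺; concat⁺; upTo⁺)
import Data.List.Relation.Unary.Unique.DecPropositional as UniqueDec
open import Data.List.Relation.Binary.Disjoint.Propositional using (Disjoint)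
open import Data.List.Relation.Binary.Permutation.Propositional
  using (_↭_; prep; swap; ↭-refl; ↭-trans; ↭-sym)
open import Data.List.Relation.Binary.Permutation.Propositional.Properties using (∈-resp-↭)
open import Relation.Nullary using (¬_; Dec; yes; no; ¬?)
open import Relation.Nullary.Decidable using (True; toWitness; isYes; via-injection; from-yes)
import Relation.Nullary.Decidable as Dec
open import Relation.Binary using (tri<; tri≈; tri>)
open import Relation.Binary.Definitions using (DecidableEquality)
open import Relation.Binary.PropositionalEquality

-- Two-coloured triples

data TwoColoured (x y z : ℕ) : Set where
  same₁₂ : x ≡ y → y ≢ z → TwoColoured x y z
  same₁₃ : x ≡ z → x ≢ y → TwoColoured x y z
  same₂₃ : y ≡ z → x ≢ y → TwoColoured x y z

distinctCount : ℕ → ℕ → ℕ → ℕ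
distinctCount x y z = length (deduplicate _≟_ (x ∷ y ∷ z ∷ []))

private
  ≡ᵇ-true : ∀ x y → (x ≡ᵇ y) ≡ true → x ≡ y
  ≡ᵇ-true x y e = ≡ᵇ⇒≡ x y (subst T (sym e) _)

  ≡ᵇ-false : ∀ x y → (x ≡ᵇ y) ≡ false → x ≢ y
  ≡ᵇ-false x y e x≡y = subst T e (≡⇒≡ᵇ x y x≡y)

distinctCount≡2⇔twoColoured : ∀ x y z → distinctCount x y z ≡ 2 ⇔ TwoColoured x y z
distinctCount≡2⇔twoColoured x y z = mk⇔ to from
  where
  to : distinctCount x y z ≡ 2 → TwoColoured x y z
  to c with y ≡ᵇ z in yz | x ≡ᵇ y in xy
  to () | true  | true
  ... | true  | false = same₂₃ (≡ᵇ-true y z yz) (≡ᵇ-false x y xy)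
  ... | false | true with x ≡ᵇ z in xz
  ...   | true  = ⊥-elim (≡ᵇ-false y z yz (trans (sym (≡ᵇ-true x y xy)) (≡ᵇ-true x z xz)))
  ...   | false = same₁₂ (≡ᵇ-true x y xy) (≡ᵇ-false y z yz)
  to c | false | false with x ≡ᵇ z in xz
  ...   | true  = same₁₃ (≡ᵇ-true x z xz) (≡ᵇ-false x y xy)
  to () | false | false | false

  from : TwoColoured x y z → distinctCount x y z ≡ 2
  from t with y ≡ᵇ z in yz | x ≡ᵇ y in xy
  ... | true  | false = refl
  ... | true  | true  = ⊥-elim (allEqual t (≡ᵇ-true x y xy) (≡ᵇ-true y z yz))
    where
    allEqual : TwoColoured x y z → x ≡ y → y ≡ z → ⊥
    allEqual (same₁₂ _ y≢z) _ y≡z = y≢z y≡z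
    allEqual (same₁₃ _ x≢y) x≡y _ = x≢y x≡y
    allEqual (same₂₃ _ x≢y) x≡y _ = x≢y x≡y
  ... | false | true with x ≡ᵇ z in xz
  ...   | true  = ⊥-elim (≡ᵇ-false y z yz (trans (sym (≡ᵇ-true x y xy)) (≡ᵇ-true x z xz)))
  ...   | false = refl
  from t | false | false with x ≡ᵇ z in xz
  ...   | true  = refl
  ...   | false = ⊥-elim (allDistinct t (≡ᵇ-false x y xy) (≡ᵇ-false y z yz) (≡ᵇ-false x z xz))
    where
    allDistinct : TwoColoured x y z → x ≢ y → y ≢ z → x ≢ z → ⊥
    allDistinct (same₁₂ x≡y _) x≢y _ _ = x≢y x≡y
    allDistinct (same₁₃ x≡z _) _ _ x≢z = x≢z x≡z
    allDistinct (same₂₃ y≡z _) _ y≢z _ = y≢z y≡z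

twoColoured? : ∀ x y z → Dec (TwoColoured x y z)
twoColoured? x y z = Dec.map (distinctCount≡2⇔twoColoured x y z) (distinctCount x y z ≟ 2)

twoColoured-swap₁₂ : ∀ {x y z} → TwoColoured x y z → TwoColoured y x z
twoColoured-swap₁₂ (same₁₂ x≡y y≢z) = same₁₂ (sym x≡y) (λ x≡z → y≢z (trans (sym x≡y) x≡z))
twoColoured-swap₁₂ (same₁₃ x≡z x≢y) = same₂₃ x≡z (x≢y ∘ sym)
twoColoured-swap₁₂ (same₂₃ y≡z x≢y) = same₁₃ y≡z (x≢y ∘ sym)

twoColoured-swap₂₃ : ∀ {x y z} → TwoColoured x y z → TwoColoured x z y
twoColoured-swap₂₃ (same₁₂ x≡y y≢z) = same₁₃ x≡y (λ x≡z → y≢z (trans (sym x≡y) x≡z))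
twoColoured-swap₂₃ (same₁₃ x≡z x≢y) = same₁₂ x≡z (λ z≡y → x≢y (trans x≡z z≡y))
twoColoured-swap₂₃ (same₂₃ y≡z x≢y) = same₂₃ (sym y≡z) (λ x≡z → x≢y (trans x≡z (sym y≡z)))

twoColoured-swap₁₃ : ∀ {x y z} → TwoColoured x y z → TwoColoured z y x
twoColoured-swap₁₃ = twoColoured-swap₁₂ ∘ twoColoured-swap₂₃ ∘ twoColoured-swap₁₂

twoColoured⇒≢ : ∀ {w a} → TwoColoured w a a → w ≢ a
twoColoured⇒≢ (same₁₂ _ a≢a) _   = a≢a refl
twoColoured⇒≢ (same₁₃ _ w≢a) w≡a = w≢a w≡a
twoColoured⇒≢ (same₂₃ _ w≢a) w≡a = w≢a w≡a

twoColoured⇒≡⊎≡ : ∀ {w a b} → TwoColoured w a b → a ≢ b → w ≡ a ⊎ w ≡ b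
twoColoured⇒≡⊎≡ (same₁₂ w≡a _) _   = inj₁ w≡a
twoColoured⇒≡⊎≡ (same₁₃ w≡b _) _   = inj₂ w≡b
twoColoured⇒≡⊎≡ (same₂₃ a≡b _) a≢b = ⊥-elim (a≢b a≡b)

twoColoured⇒≡ : ∀ {w a b} → TwoColoured w a b → a ≢ b → w ≢ a → w ≡ b
twoColoured⇒≡ t a≢b w≢a with twoColoured⇒≡⊎≡ t a≢b
... | inj₁ w≡a = ⊥-elim (w≢a w≡a)
... | inj₂ w≡b = w≡b

¬twoColoured-constant : ∀ {a} → ¬ TwoColoured a a a
¬twoColoured-constant t = twoColoured⇒≢ t refl

¬twoColoured-rainbow : ∀ {x y z} → x ≢ y → y ≢ z → x ≢ z → ¬ TwoColoured x y z
¬twoColoured-rainbow x≢y _ _ (same₁₂ x≡y _) = x≢y x≡y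
¬twoColoured-rainbow _ _ x≢z (same₁₃ x≡z _) = x≢z x≡z
¬twoColoured-rainbow _ y≢z _ (same₂₃ y≡z _) = y≢z y≡z

¬twoColoured-ab-aa-bb : ∀ {w a b} → a ≢ b → TwoColoured w a b → TwoColoured w a a → ¬ TwoColoured w b b
¬twoColoured-ab-aa-bb a≢b wab waa wbb =
  twoColoured⇒≢ wbb (twoColoured⇒≡ wab a≢b (twoColoured⇒≢ waa))

twoColoured-common : ∀ {w a b c} → a ≢ b → a ≢ c → b ≢ c → TwoColoured w a b → TwoColoured w a c → w ≡ a
twoColoured-common a≢b a≢c b≢c wab wac with twoColoured⇒≡⊎≡ wab a≢b | twoColoured⇒≡⊎≡ wac a≢c
... | inj₁ w≡a | _        = w≡a
... | inj₂ _   | inj₁ w≡a = w≡a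
... | inj₂ w≡b | inj₂ w≡c = ⊥-elim (b≢c (trans (sym w≡b) w≡c))

-- Subsets spanned by three vertices

select : ∀ {n} {A : Set} → Subset n → (Fin n → A) → List A
select Vec.[] g = []
select (true Vec.∷ p) g = g fzero ∷ select p (g ∘ fsuc)
select (false Vec.∷ p) g = select p (g ∘ fsuc)

private
  filter-map-fsuc : ∀ {n} {A : Set} b (p : Subset n) (g : Fin (suc n) → A) (xs : List (Fin n)) →
    map g (filter (_∈? (b Vec.∷ p)) (map fsuc xs)) ≡ map (g ∘ fsuc) (filter (_∈? p) xs)
  filter-map-fsuc b p g [] = refl
  filter-map-fsuc b p g (x ∷ xs) with x ∈? p
  ... | yes _ = cong (g (fsuc x) ∷_) (filter-map-fsuc b p g xs)
  ... | no _  = filter-map-fsuc b p g xs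

map-members-tail : ∀ {n} {A : Set} b (p : Subset n) (g : Fin (suc n) → A) →
  map g (filter (_∈? (b Vec.∷ p)) (List.tabulate fsuc)) ≡ select p (g ∘ fsuc)

map-members : ∀ {n} {A : Set} (p : Subset n) (g : Fin n → A) → map g (members p) ≡ select p g
map-members Vec.[] g = refl
map-members (true Vec.∷ p) g = cong (g fzero ∷_) (map-members-tail true p g)
map-members (false Vec.∷ p) g = map-members-tail false p g

map-members-tail {n} b p g = begin
  map g (filter (_∈? (b Vec.∷ p)) (List.tabulate fsuc))
    ≡⟨ cong (map g ∘ filter (_∈? (b Vec.∷ p))) (map-tabulate id fsuc) ⟨
  map g (filter (_∈? (b Vec.∷ p)) (map fsuc (allFin n)))
    ≡⟨ filter-map-fsuc b p g (allFin n) ⟩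
  map (g ∘ fsuc) (members p)
    ≡⟨ map-members p (g ∘ fsuc) ⟩
  select p (g ∘ fsuc)
    ∎
  where open ≡-Reasoning

∣∣≡length-select : ∀ {n} {A : Set} (p : Subset n) (g : Fin n → A) → ∣ p ∣ ≡ length (select p g)
∣∣≡length-select Vec.[] g = refl
∣∣≡length-select (true Vec.∷ p) g = cong suc (∣∣≡length-select p (g ∘ fsuc))
∣∣≡length-select (false Vec.∷ p) g = ∣∣≡length-select p (g ∘ fsuc)

between : ℕ → ℕ → (ℕ → Bool) → List ℕ
between o zero P = []
between o (suc n) P = if P o then o ∷ between (suc o) n P else between (suc o) n P

between-suc : ∀ o n (P : ℕ → Bool) → between (suc o) n P ≡ map suc (between o n (P ∘ suc))
between-suc o zero P = refl
between-suc o (suc n) P with P (suc o)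
... | true  = cong (suc o ∷_) (between-suc (suc o) n P)
... | false = between-suc (suc o) n P

select-tabulate-suc : ∀ n (P : ℕ → Bool) (G : ℕ → ℕ) →
  select (tabulate {n = n} (P ∘ suc ∘ toℕ)) (G ∘ suc ∘ toℕ) ≡ map G (between 1 n P)

select-tabulate : ∀ n (P : ℕ → Bool) (G : ℕ → ℕ) →
  select (tabulate {n = n} (P ∘ toℕ)) (G ∘ toℕ) ≡ map G (between 0 n P)
select-tabulate zero P G = refl
select-tabulate (suc n) P G with P 0
... | true  = cong (G 0 ∷_) (select-tabulate-suc n P G)
... | false = select-tabulate-suc n P G

select-tabulate-suc n P G = begin
  select (tabulate {n = n} (P ∘ suc ∘ toℕ)) (G ∘ suc ∘ toℕ) ≡⟨ select-tabulate n (P ∘ suc) (G ∘ suc) ⟩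
  map (G ∘ suc) (between 0 n (P ∘ suc))             ≡⟨ map-∘ (between 0 n (P ∘ suc)) ⟩
  map G (map suc (between 0 n (P ∘ suc)))           ≡⟨ cong (map G) (between-suc 0 n P) ⟨
  map G (between 1 n P)                             ∎
  where open ≡-Reasoning

private
  shiftUpper : ∀ {o n y} → y < o + suc n → y < suc o + n
  shiftUpper {o} {n} y< = ≤-trans y< (≤-reflexive (+-suc o n))

between-ascending : ∀ (P : ℕ → Bool) n o {ys : List ℕ} → AllPairs _<_ ys →
  All (o ≤_) ys → All (_< o + n) ys →
  (∀ y → o ≤ y → T (P y) → y ∈ ys) → All (T ∘ P) ys → between o n P ≡ ys
between-ascending P zero o {[]} _ _ _ _ _ = refl
between-ascending P zero o {y ∷ _} _ (o≤y ∷ _) (y<o+0 ∷ _) _ _ =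
  ⊥-elim (<⇒≱ (subst (y <_) (+-identityʳ o) y<o+0) o≤y)
between-ascending P (suc n) o {ys} asc lower upper complete sound with P o in Po
... | false = between-ascending P n (suc o) asc (All.zipWith o<y (lower , sound)) (All.map shiftUpper upper)
  (λ y o<y → complete y (<⇒≤ o<y)) sound
  where
  o<y : ∀ {y} → o ≤ y × T (P y) → o < y
  o<y {y} (o≤y , Py) = ≤∧≢⇒< o≤y λ { refl → subst T Po Py }
... | true with complete o ≤-refl (Equivalence.from T-≡ Po) | asc | lower | upper | sound
...   | here refl | o<ys' ∷ asc' | _ ∷ _ | _ ∷ upper' | _ ∷ sound' =
  cong (o ∷_) (between-ascending P n (suc o) asc' o<ys' (All.map shiftUpper upper') complete' sound')
  where
  complete' : ∀ y → suc o ≤ y → T (P y) → y ∈ _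
  complete' y o<y Py with complete y (<⇒≤ o<y) Py
  ... | here refl = ⊥-elim (<-irrefl refl o<y)
  ... | there y∈ = y∈
...   | there o∈ys' | y<ys' ∷ _ | o≤y ∷ _ | _ | _ = ⊥-elim (<⇒≱ (All.lookup y<ys' o∈ys') o≤y)

∈⇔T-any-≡ᵇ : ∀ y (xs : List ℕ) → y ∈ xs ⇔ T (any (y ≡ᵇ_) xs)
∈⇔T-any-≡ᵇ y xs = mk⇔ (Equivalence.to any⇔ ∘ Any.map (≡⇒≡ᵇ y _))
                       (Any.map (≡ᵇ⇒≡ y _) ∘ Equivalence.from any⇔)

1<c<3⇔c≡2 : ∀ {c} → (1 < c × c < 3) ⇔ c ≡ 2
1<c<3⇔c≡2 = mk⇔ to λ { refl → s≤s (s≤s z≤n) , s≤s (s≤s (s≤s z≤n)) }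
  where
  to : ∀ {c} → 1 < c × c < 3 → c ≡ 2
  to (s≤s (s≤s z≤n) , s≤s (s≤s (s≤s z≤n))) = refl

members-toSubset : ∀ n (G : ℕ → ℕ) {a b c} → a < b → b < c → c < n →
  ∀ xs → xs ↭ a ∷ b ∷ c ∷ [] → map (G ∘ toℕ) (members (toSubset n xs)) ≡ G a ∷ G b ∷ G c ∷ []
members-toSubset n G {a} {b} {c} a<b b<c c<n xs xs↭abc = begin
  map (G ∘ toℕ) (members (toSubset n xs))  ≡⟨ map-members (toSubset n xs) (G ∘ toℕ) ⟩
  select (toSubset n xs) (G ∘ toℕ)         ≡⟨ select-tabulate n (λ y → any (y ≡ᵇ_) xs) G ⟩
  map G (between 0 n (λ y → any (y ≡ᵇ_) xs))
    ≡⟨ cong (map G) (between-ascending _ n 0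
         ((a<b ∷ <-trans a<b b<c ∷ []) ∷ (b<c ∷ []) ∷ [] ∷ [])
         (z≤n ∷ z≤n ∷ z≤n ∷ [])
         (<-trans (<-trans a<b b<c) c<n ∷ <-trans b<c c<n ∷ c<n ∷ [])
         (λ y _ → ∈-resp-↭ xs↭abc ∘ Equivalence.from (∈⇔T-any-≡ᵇ y xs))
         (All.tabulate λ {y} → Equivalence.to (∈⇔T-any-≡ᵇ y xs) ∘ ∈-resp-↭ (↭-sym xs↭abc))) ⟩
  map G (a ∷ b ∷ c ∷ [])                   ∎
  where open ≡-Reasoning

properOn⇔twoColoured : ∀ n (G : ℕ → ℕ) {a b c} → a < b → b < c → c < n →
  ∀ xs → xs ↭ a ∷ b ∷ c ∷ [] → ProperOn (G ∘ toℕ) (toSubset n xs) ⇔ TwoColoured (G a) (G b) (G c)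
properOn⇔twoColoured n G {a} {b} {c} a<b b<c c<n xs xs↭abc =
  subst (λ m → (1 < numColors (G ∘ toℕ) e × numColors (G ∘ toℕ) e < m) ⇔ _) (sym ∣e∣≡3)
    (subst (λ k → (1 < k × k < 3) ⇔ _) (sym numColors≡)
      (distinctCount≡2⇔twoColoured (G a) (G b) (G c) ⇔-∘ 1<c<3⇔c≡2))
  where
  e : Subset n
  e = toSubset n xs
  colours : map (G ∘ toℕ) (members e) ≡ G a ∷ G b ∷ G c ∷ []
  colours = members-toSubset n G a<b b<c c<n xs xs↭abc
  numColors≡ : numColors (G ∘ toℕ) e ≡ distinctCount (G a) (G b) (G c)
  numColors≡ = cong (length ∘ deduplicate _≟_) colours
  ∣e∣≡3 : ∣ e ∣ ≡ 3
  ∣e∣≡3 = trans (∣∣≡length-select e (G ∘ toℕ))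
                (cong length (trans (sym (map-members e (G ∘ toℕ))) colours))

properOn-cong : ∀ {n} {f g : Fin n → ℕ} (e : Subset n) → (∀ x → f x ≡ g x) → ProperOn f e → ProperOn g e
properOn-cong e f≗g =
  subst (λ c → 1 < c × c < Subset.∣ e ∣) (cong (length ∘ deduplicate _≟_) (map-cong f≗g (members e)))

∈-toSubset : ∀ {n} (x : Fin n) xs → toℕ x ∈ xs → x Subset.∈ toSubset n xs
∈-toSubset x xs x∈ = lookup⇒[]= x _
  (trans (lookup∘tabulate _ x) (Equivalence.to T-≡ (Equivalence.to (∈⇔T-any-≡ᵇ (toℕ x) xs) x∈)))

-- The layers of a proper colouring

record Triple : Set where
  constructor ⟨_,_,_⟩
  field
    c₀ c₁ c₂ : ℕ
open Triple public

TwoColouredᵗ : Triple → Set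
TwoColouredᵗ X = TwoColoured (c₀ X) (c₁ X) (c₂ X)

rotate reflect : Triple → Triple
rotate  ⟨ x₀ , x₁ , x₂ ⟩ = ⟨ x₁ , x₂ , x₀ ⟩
reflect ⟨ x₀ , x₁ , x₂ ⟩ = ⟨ x₀ , x₂ , x₁ ⟩

twoColoured-rotate : ∀ {X} → TwoColouredᵗ X → TwoColouredᵗ (rotate X)
twoColoured-rotate = twoColoured-swap₂₃ ∘ twoColoured-swap₁₂

twoColoured-reflect : ∀ {X} → TwoColouredᵗ X → TwoColouredᵗ (reflect X)
twoColoured-reflect = twoColoured-swap₂₃

data Shape (X : Triple) : Set where
  constant    : c₀ X ≡ c₁ X → c₁ X ≡ c₂ X → Shape X
  twoColoured : TwoColouredᵗ X → Shape X
  rainbow     : c₀ X ≢ c₁ X → c₁ X ≢ c₂ X → c₀ X ≢ c₂ X → Shape X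

shape : ∀ X → Shape X
shape ⟨ x₀ , x₁ , x₂ ⟩ with x₀ ≟ x₁ | x₁ ≟ x₂ | x₀ ≟ x₂
... | yes x₀≡x₁ | yes x₁≡x₂ | _         = constant x₀≡x₁ x₁≡x₂
... | yes x₀≡x₁ | no  x₁≢x₂ | _         = twoColoured (same₁₂ x₀≡x₁ x₁≢x₂)
... | no  x₀≢x₁ | yes x₁≡x₂ | _         = twoColoured (same₂₃ x₁≡x₂ x₀≢x₁)
... | no  x₀≢x₁ | no  _     | yes x₀≡x₂ = twoColoured (same₁₃ x₀≡x₂ x₀≢x₁)
... | no  x₀≢x₁ | no  x₁≢x₂ | no  x₀≢x₂ = rainbow x₀≢x₁ x₁≢x₂ x₀≢x₂

-- The six edges {v_{q+1,j}, v_{q,j}, v_{q,j+t}} between consecutive layers X = V_q, Y = V_{q+1}.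
record Link (X Y : Triple) : Set where
  field
    link₀₁ : TwoColoured (c₀ Y) (c₀ X) (c₁ X)
    link₀₂ : TwoColoured (c₀ Y) (c₀ X) (c₂ X)
    link₁₂ : TwoColoured (c₁ Y) (c₁ X) (c₂ X)
    link₁₀ : TwoColoured (c₁ Y) (c₁ X) (c₀ X)
    link₂₀ : TwoColoured (c₂ Y) (c₂ X) (c₀ X)
    link₂₁ : TwoColoured (c₂ Y) (c₂ X) (c₁ X)
open Link

link-rotate : ∀ {X Y} → Link X Y → Link (rotate X) (rotate Y)
link-rotate l = record
  { link₀₁ = link₁₂ l ; link₀₂ = link₁₀ l ; link₁₂ = link₂₀ l
  ; link₁₀ = link₂₁ l ; link₂₀ = link₀₁ l ; link₂₁ = link₀₂ l }

link-reflect : ∀ {X Y} → Link X Y → Link (reflect X) (reflect Y)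
link-reflect l = record
  { link₀₁ = link₀₂ l ; link₀₂ = link₀₁ l ; link₁₂ = link₂₁ l
  ; link₁₀ = link₂₀ l ; link₂₀ = link₁₀ l ; link₂₁ = link₁₂ l }

link-forced : ∀ {a b Y} → a ≢ b → Link ⟨ a , a , b ⟩ Y → TwoColouredᵗ Y → Y ≡ ⟨ b , b , a ⟩
link-forced {a} {b} {⟨ y₀ , y₁ , y₂ ⟩} a≢b l tY
  with twoColoured⇒≡ (link₀₂ l) a≢b (twoColoured⇒≢ (link₀₁ l))
     | twoColoured⇒≡ (link₁₂ l) a≢b (twoColoured⇒≢ (link₁₀ l))
... | refl | refl with twoColoured⇒≡⊎≡ (link₂₀ l) (a≢b ∘ sym)
...   | inj₁ refl = ⊥-elim (twoColoured⇒≢ tY refl)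
...   | inj₂ refl = refl

link-link-returns : ∀ {X Y Z} → TwoColouredᵗ X → Link X Y → TwoColouredᵗ Y → Link Y Z → TwoColouredᵗ Z →
                    Z ≡ X
link-link-returns {⟨ a , _ , b ⟩} (same₁₂ refl a≢b) lXY tY lYZ tZ = returns a≢b lXY tY lYZ tZ
  where
  returns : ∀ {a b Y Z} → a ≢ b → Link ⟨ a , a , b ⟩ Y → TwoColouredᵗ Y → Link Y Z → TwoColouredᵗ Z →
            Z ≡ ⟨ a , a , b ⟩
  returns a≢b lXY tY lYZ tZ with link-forced a≢b lXY tY
  ... | refl = link-forced (a≢b ∘ sym) lYZ tZ
link-link-returns {⟨ a , b , _ ⟩} (same₁₃ refl a≢b) lXY tY lYZ tZ =
  cong reflect (link-link-returns (same₁₂ refl a≢b) (link-reflect lXY) (twoColoured-reflect tY)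
                                  (link-reflect lYZ) (twoColoured-reflect tZ))
link-link-returns {⟨ a , b , _ ⟩} (same₂₃ refl a≢b) lXY tY lYZ tZ =
  cong (rotate ∘ rotate)
    (link-link-returns (same₁₂ refl (a≢b ∘ sym)) (link-rotate lXY) (twoColoured-rotate tY)
                       (link-rotate lYZ) (twoColoured-rotate tZ))

-- The six edges through u and v, where X = V_1 and Z = V_{2k}.
record CapsColoured (u v : ℕ) (X Z : Triple) : Set where
  field
    u₀₁  : TwoColoured u (c₀ X) (c₁ X)
    v₁₂  : TwoColoured v (c₁ X) (c₂ X)
    u₀Z₁ : TwoColoured u (c₀ X) (c₁ Z)
    v₁Z₂ : TwoColoured v (c₁ X) (c₂ Z)
    u₁Z₀ : TwoColoured u (c₁ X) (c₀ Z)
    v₂Z₁ : TwoColoured v (c₂ X) (c₁ Z)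
open CapsColoured

-- V_1 has no edge of its own, so besides two-coloured it may be constant or rainbow.
caps-incompatible : ∀ {u v X Y} → Link X Y → TwoColouredᵗ Y → ¬ CapsColoured u v X Y
caps-incompatible {X = X} lXY tY caps with shape X
caps-incompatible {u} {v} {⟨ a , _ , _ ⟩} {⟨ y₀ , y₁ , y₂ ⟩} lXY tY caps | constant refl refl
  with twoColoured⇒≡ (u₁Z₀ caps) (twoColoured⇒≢ (link₀₁ lXY) ∘ sym) (twoColoured⇒≢ (u₀₁ caps))
     | twoColoured⇒≡ (u₀Z₁ caps) (twoColoured⇒≢ (link₁₀ lXY) ∘ sym) (twoColoured⇒≢ (u₀₁ caps))
     | twoColoured⇒≡ (v₂Z₁ caps) (twoColoured⇒≢ (link₁₀ lXY) ∘ sym) (twoColoured⇒≢ (v₁₂ caps))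
     | twoColoured⇒≡ (v₁Z₂ caps) (twoColoured⇒≢ (link₂₀ lXY) ∘ sym) (twoColoured⇒≢ (v₁₂ caps))
... | refl | refl | refl | refl = ¬twoColoured-constant tY
caps-incompatible {X = ⟨ a , _ , b ⟩} {⟨ y₀ , y₁ , y₂ ⟩} lXY tY caps | twoColoured (same₁₂ refl a≢b)
  with link-forced a≢b lXY tY
... | refl = ¬twoColoured-ab-aa-bb a≢b (v₁₂ caps) (v₁Z₂ caps) (v₂Z₁ caps)
caps-incompatible {X = ⟨ a , b , _ ⟩} {⟨ y₀ , y₁ , y₂ ⟩} lXY tY caps | twoColoured (same₁₃ refl a≢b)
  with link-forced a≢b (link-reflect lXY) (twoColoured-reflect tY)
... | refl = ¬twoColoured-ab-aa-bb a≢b (u₀₁ caps) (u₀Z₁ caps) (u₁Z₀ caps)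
caps-incompatible {X = ⟨ a , b , _ ⟩} {⟨ y₀ , y₁ , y₂ ⟩} lXY tY caps | twoColoured (same₂₃ refl a≢b)
  with link-forced (a≢b ∘ sym) (link-rotate lXY) (twoColoured-rotate tY)
... | refl = ¬twoColoured-ab-aa-bb a≢b (u₀₁ caps) (u₀Z₁ caps) (u₁Z₀ caps)
caps-incompatible {X = ⟨ x₀ , x₁ , x₂ ⟩} {⟨ y₀ , y₁ , y₂ ⟩} lXY tY caps | rainbow x₀≢x₁ x₁≢x₂ x₀≢x₂
  with twoColoured-common x₀≢x₁ x₀≢x₂ x₁≢x₂ (link₀₁ lXY) (link₀₂ lXY)
     | twoColoured-common x₁≢x₂ (x₀≢x₁ ∘ sym) (x₀≢x₂ ∘ sym) (link₁₂ lXY) (link₁₀ lXY)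
     | twoColoured-common (x₀≢x₂ ∘ sym) (x₁≢x₂ ∘ sym) (x₀≢x₁) (link₂₀ lXY) (link₂₁ lXY)
... | refl | refl | refl = ¬twoColoured-rainbow x₀≢x₁ x₁≢x₂ x₀≢x₂ tY

module _ (L : ℕ → Triple) (K : ℕ)
         (layer : ∀ m → 1 ≤ m → m ≤ K → TwoColouredᵗ (L m))
         (link : ∀ m → m < K → Link (L m) (L (suc m))) where

  odd-layers-equal : ∀ t → suc (t + t) ≤ K → L (suc (t + t)) ≡ L 1
  odd-layers-equal zero _ = refl
  odd-layers-equal (suc t) m+2≤K rewrite +-suc t t = begin
    L (suc (suc m))  ≡⟨ link-link-returns (layer m (s≤s z≤n) m≤K) (link m m<K) (layer (suc m) (s≤s z≤n) m<K)
                                          (link (suc m) m+2≤K) (layer (suc (suc m)) (s≤s z≤n) m+2≤K) ⟩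
    L m              ≡⟨ odd-layers-equal t m≤K ⟩
    L 1              ∎
    where
    open ≡-Reasoning
    m = suc (t + t)
    m<K : m < K
    m<K = ≤-trans (n≤1+n _) m+2≤K
    m≤K : m ≤ K
    m≤K = <⇒≤ m<K

chain-uncolourable : ∀ T (L : ℕ → Triple) u v →
  (∀ m → 1 ≤ m → m ≤ suc (T + T) → TwoColouredᵗ (L m)) →
  (∀ m → m < suc (T + T) → Link (L m) (L (suc m))) →
  ¬ CapsColoured u v (L 0) (L (suc (T + T)))
chain-uncolourable T L u v layer link caps =
  caps-incompatible (link 0 (s≤s z≤n)) (layer 1 (s≤s z≤n) (s≤s z≤n))
    (subst (CapsColoured u v (L 0)) (odd-layers-equal L K layer link T ≤-refl) caps)
  where K = suc (T + T)

-- The edges of H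

-- v_{m+1,r+1}, for a layer m < 2k and a position r < 3
vertex : ℕ → ℕ → ℕ
vertex m r = 2 + (m * 3 + r)

vtx≡vertex : ∀ m r → 3 * suc m + suc r ∸ 2 ≡ vertex m r
vtx≡vertex m r = trans (cong (λ z → z + suc r ∸ 2) (*-comm 3 (suc m))) (cong suc (+-suc (m * 3) r))

quot3 rem3 : ℕ → ℕ
quot3 (suc (suc (suc n))) = suc (quot3 n)
quot3 _                   = 0
rem3 (suc (suc (suc n))) = rem3 n
rem3 n                   = n

quot3-*3+ : ∀ m {r} → r < 3 → quot3 (m * 3 + r) ≡ m
quot3-*3+ zero    (s≤s z≤n)             = refl
quot3-*3+ zero    (s≤s (s≤s z≤n))       = refl
quot3-*3+ zero    (s≤s (s≤s (s≤s z≤n))) = refl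
quot3-*3+ (suc m) r<3                   = cong suc (quot3-*3+ m r<3)

rem3-*3+ : ∀ m {r} → r < 3 → rem3 (m * 3 + r) ≡ r
rem3-*3+ zero    (s≤s z≤n)             = refl
rem3-*3+ zero    (s≤s (s≤s z≤n))       = refl
rem3-*3+ zero    (s≤s (s≤s (s≤s z≤n))) = refl
rem3-*3+ (suc m) r<3                   = rem3-*3+ m r<3

quot3*3+rem3 : ∀ z → quot3 z * 3 + rem3 z ≡ z
quot3*3+rem3 0                   = refl
quot3*3+rem3 1                   = refl
quot3*3+rem3 2                   = refl
quot3*3+rem3 (suc (suc (suc z))) = cong (3 +_) (quot3*3+rem3 z)

rem3<3 : ∀ z → rem3 z < 3
rem3<3 0                   = s≤s z≤n
rem3<3 1                   = s≤s (s≤s z≤n)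
rem3<3 2                   = s≤s (s≤s (s≤s z≤n))
rem3<3 (suc (suc (suc z))) = rem3<3 z

quot3<  : ∀ {z N} → z < 3 * N → quot3 z < N
quot3< {z} {N} z<3N = *-cancelʳ-< 3 (quot3 z) N (begin-strict
  quot3 z * 3           ≤⟨ m≤m+n _ (rem3 z) ⟩
  quot3 z * 3 + rem3 z  ≡⟨ quot3*3+rem3 z ⟩
  z                     <⟨ z<3N ⟩
  3 * N                 ≡⟨ *-comm 3 N ⟩
  N * 3                 ∎)
  where open ≤-Reasoning

-- The spoke (j, t) is the edge {v_{q+1,j}, v_{q,j}, v_{q,j+t}}.
data Spoke : Set where
  s₁₁ s₁₂ s₂₁ s₂₂ s₃₁ s₃₂ : Spoke

hub rim : Spoke → ℕ
hub s₁₁ = 0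
hub s₁₂ = 0
hub s₂₁ = 1
hub s₂₂ = 1
hub s₃₁ = 2
hub s₃₂ = 2
rim s₁₁ = 1
rim s₁₂ = 2
rim s₂₁ = 2
rim s₂₂ = 0
rim s₃₁ = 0
rim s₃₂ = 1

hub<3 : ∀ s → hub s < 3
hub<3 s₁₁ = s≤s z≤n
hub<3 s₁₂ = s≤s z≤n
hub<3 s₂₁ = s≤s (s≤s z≤n)
hub<3 s₂₂ = s≤s (s≤s z≤n)
hub<3 s₃₁ = s≤s (s≤s (s≤s z≤n))
hub<3 s₃₂ = s≤s (s≤s (s≤s z≤n))

rim<3 : ∀ s → rim s < 3
rim<3 s₁₁ = s≤s (s≤s z≤n)
rim<3 s₁₂ = s≤s (s≤s (s≤s z≤n))
rim<3 s₂₁ = s≤s (s≤s (s≤s z≤n))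
rim<3 s₂₂ = s≤s z≤n
rim<3 s₃₁ = s≤s z≤n
rim<3 s₃₂ = s≤s (s≤s z≤n)

spokeAt : ℕ → ℕ → Spoke
spokeAt 0 1 = s₁₁
spokeAt 0 _ = s₁₂
spokeAt 1 2 = s₂₁
spokeAt 1 _ = s₂₂
spokeAt 2 0 = s₃₁
spokeAt _ _ = s₃₂

-- the six new edges, named after their vertices (K for the last layer V_{2k})
data Cap : Set where
  u₁₂ v₂₃ u₁K₂ v₂K₃ u₂K₁ v₃K₂ : Cap

data Edge : Set where
  layerEdge : ℕ → Edge
  spokeEdge : ℕ → Spoke → Edge
  capEdge   : Cap → Edge

vertices : ℕ → Edge → List ℕ
vertices K (layerEdge m)   = vertex m 0 ∷ vertex m 1 ∷ vertex m 2 ∷ []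
vertices K (spokeEdge m s) = vertex (suc m) (hub s) ∷ vertex m (hub s) ∷ vertex m (rim s) ∷ []
vertices K (capEdge u₁₂)   = uV ∷ vertex 0 0 ∷ vertex 0 1 ∷ []
vertices K (capEdge v₂₃)   = vV ∷ vertex 0 1 ∷ vertex 0 2 ∷ []
vertices K (capEdge u₁K₂)  = uV ∷ vertex 0 0 ∷ vertex K 1 ∷ []
vertices K (capEdge v₂K₃)  = vV ∷ vertex 0 1 ∷ vertex K 2 ∷ []
vertices K (capEdge u₂K₁)  = uV ∷ vertex 0 1 ∷ vertex K 0 ∷ []
vertices K (capEdge v₃K₂)  = vV ∷ vertex 0 2 ∷ vertex K 1 ∷ []

-- Layer edges have positions (0, 1, 2), spokes (j, j, j + t); a cap edge through u or v is
-- determined by the position of its second vertex and by whether its third lies in layer 0.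
decode : List ℕ → Edge
decode (0 ∷ suc (suc b) ∷ suc (suc c) ∷ []) with rem3 b | quot3 c
... | 1 | _     = capEdge u₂K₁
... | _ | zero  = capEdge u₁₂
... | _ | suc _ = capEdge u₁K₂
decode (1 ∷ suc (suc b) ∷ suc (suc c) ∷ []) with rem3 b | quot3 c
... | 2 | _     = capEdge v₃K₂
... | _ | zero  = capEdge v₂₃
... | _ | suc _ = capEdge v₂K₃
decode (suc (suc a) ∷ suc (suc b) ∷ suc (suc c) ∷ []) with rem3 a | rem3 b
... | 0 | 1 = layerEdge (quot3 a)
... | p | _ = spokeEdge (quot3 b) (spokeAt p (rem3 c))
decode _ = layerEdge 0

decode-vertices : ∀ K D → decode (vertices (suc K) D) ≡ D
decode-vertices K (layerEdge m)
  rewrite rem3-*3+ m {0} (s≤s z≤n) | rem3-*3+ m {1} (s≤s (s≤s z≤n)) | quot3-*3+ m {0} (s≤s z≤n) = refl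
decode-vertices K (spokeEdge m s) = decode-spoke s
  where
  decode-spoke : ∀ s → decode (vertices (suc K) (spokeEdge m s)) ≡ spokeEdge m s
  decode-spoke s₁₁ rewrite rem3-*3+ m (hub<3 s₁₁) | quot3-*3+ m (hub<3 s₁₁) | rem3-*3+ m (rim<3 s₁₁) = refl
  decode-spoke s₁₂ rewrite rem3-*3+ m (hub<3 s₁₂) | quot3-*3+ m (hub<3 s₁₂) | rem3-*3+ m (rim<3 s₁₂) = refl
  decode-spoke s₂₁ rewrite rem3-*3+ m (hub<3 s₂₁) | quot3-*3+ m (hub<3 s₂₁) | rem3-*3+ m (rim<3 s₂₁) = refl
  decode-spoke s₂₂ rewrite rem3-*3+ m (hub<3 s₂₂) | quot3-*3+ m (hub<3 s₂₂) | rem3-*3+ m (rim<3 s₂₂) = refl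
  decode-spoke s₃₁ rewrite rem3-*3+ m (hub<3 s₃₁) | quot3-*3+ m (hub<3 s₃₁) | rem3-*3+ m (rim<3 s₃₁) = refl
  decode-spoke s₃₂ rewrite rem3-*3+ m (hub<3 s₃₂) | quot3-*3+ m (hub<3 s₃₂) | rem3-*3+ m (rim<3 s₃₂) = refl
decode-vertices K (capEdge u₁₂)  = refl
decode-vertices K (capEdge v₂₃)  = refl
decode-vertices K (capEdge u₁K₂) = refl
decode-vertices K (capEdge v₂K₃) = refl
decode-vertices K (capEdge u₂K₁) = refl
decode-vertices K (capEdge v₃K₂) = refl

layerTriple : ℕ → List ℕ
layerTriple i = vtx i 1 ∷ vtx i 2 ∷ vtx i 3 ∷ []

spokeTriple : ℕ → ℕ → ℕ → List ℕ
spokeTriple q j t = vtx (suc q) j ∷ vtx q j ∷ vtx q (j + t) ∷ []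

-- an edge in the form in which it is listed in Hlemma
listed : ℕ → Edge → List ℕ
listed K (layerEdge m)     = layerTriple (suc m)
listed K (spokeEdge m s₁₁) = spokeTriple (suc m) 1 1
listed K (spokeEdge m s₁₂) = spokeTriple (suc m) 1 2
listed K (spokeEdge m s₂₁) = spokeTriple (suc m) 2 1
listed K (spokeEdge m s₂₂) = spokeTriple (suc m) 2 2
listed K (spokeEdge m s₃₁) = spokeTriple (suc m) 3 1
listed K (spokeEdge m s₃₂) = spokeTriple (suc m) 3 2
listed K (capEdge u₁₂)     = uV ∷ vtx 1 1 ∷ vtx 1 2 ∷ []
listed K (capEdge v₂₃)     = vV ∷ vtx 1 2 ∷ vtx 1 3 ∷ []
listed K (capEdge u₁K₂)    = uV ∷ vtx 1 1 ∷ vtx (suc K) (3 ∸ 1) ∷ []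
listed K (capEdge v₂K₃)    = vV ∷ vtx 1 (1 + 1) ∷ vtx (suc K) (4 ∸ 1) ∷ []
listed K (capEdge u₂K₁)    = uV ∷ vtx 1 2 ∷ vtx (suc K) (3 ∸ 2) ∷ []
listed K (capEdge v₃K₂)    = vV ∷ vtx 1 (2 + 1) ∷ vtx (suc K) (4 ∸ 2) ∷ []

private
  ∷₃-cong : ∀ {a b c a' b' c' : ℕ} → a ≡ a' → b ≡ b' → c ≡ c' →
            _≡_ {A = List ℕ} (a ∷ b ∷ c ∷ []) (a' ∷ b' ∷ c' ∷ [])
  ∷₃-cong refl refl refl = refl

listed≡vertices : ∀ K D → listed K D ≡ vertices K D
listed≡vertices K (layerEdge m)     = ∷₃-cong (vtx≡vertex m 0) (vtx≡vertex m 1) (vtx≡vertex m 2)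
listed≡vertices K (spokeEdge m s₁₁) = ∷₃-cong (vtx≡vertex (suc m) 0) (vtx≡vertex m 0) (vtx≡vertex m 1)
listed≡vertices K (spokeEdge m s₁₂) = ∷₃-cong (vtx≡vertex (suc m) 0) (vtx≡vertex m 0) (vtx≡vertex m 2)
listed≡vertices K (spokeEdge m s₂₁) = ∷₃-cong (vtx≡vertex (suc m) 1) (vtx≡vertex m 1) (vtx≡vertex m 2)
listed≡vertices K (spokeEdge m s₂₂) = ∷₃-cong (vtx≡vertex (suc m) 1) (vtx≡vertex m 1) (vtx≡vertex m 0)
listed≡vertices K (spokeEdge m s₃₁) = ∷₃-cong (vtx≡vertex (suc m) 2) (vtx≡vertex m 2) (vtx≡vertex m 0)
listed≡vertices K (spokeEdge m s₃₂) = ∷₃-cong (vtx≡vertex (suc m) 2) (vtx≡vertex m 2) (vtx≡vertex m 1)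
listed≡vertices K (capEdge u₁₂)     = refl
listed≡vertices K (capEdge v₂₃)     = refl
listed≡vertices K (capEdge u₁K₂)    = ∷₃-cong refl refl (vtx≡vertex K 1)
listed≡vertices K (capEdge v₂K₃)    = ∷₃-cong refl refl (vtx≡vertex K 2)
listed≡vertices K (capEdge u₂K₁)    = ∷₃-cong refl refl (vtx≡vertex K 0)
listed≡vertices K (capEdge v₃K₂)    = ∷₃-cong refl refl (vtx≡vertex K 1)

allSpokes : List Spoke
allSpokes = s₁₁ ∷ s₁₂ ∷ s₂₁ ∷ s₂₂ ∷ s₃₁ ∷ s₃₂ ∷ []

allCaps : List Cap
allCaps = u₁₂ ∷ v₂₃ ∷ u₁K₂ ∷ v₂K₃ ∷ u₂K₁ ∷ v₃K₂ ∷ []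

layerEdges spokeEdges : ℕ → List Edge
layerEdges K = map (layerEdge ∘ suc) (upTo K)
spokeEdges K = concatMap (λ m → map (spokeEdge m) allSpokes) (upTo K)

capEdges : List Edge
capEdges = map capEdge allCaps

-- in the order in which Hlemma lists them
edges : ℕ → List Edge
edges K = (layerEdges K ++ spokeEdges K) ++ capEdges

edgeList : ℕ → List (List ℕ)
edgeList K = HKEdgesNoV1 (suc K) ++ newEdges (suc K)

edgeList≡ : ∀ K → edgeList K ≡ map (vertices K) (edges K)
edgeList≡ K = begin
  edgeList K
    ≡⟨ cong₂ _++_ (cong₂ _++_ layers spokes) refl ⟩
  (map (listed K) (layerEdges K) ++ map (listed K) (spokeEdges K)) ++ map (listed K) capEdges
    ≡⟨ cong (_++ map (listed K) capEdges) (map-++ (listed K) (layerEdges K) (spokeEdges K)) ⟨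
  map (listed K) (layerEdges K ++ spokeEdges K) ++ map (listed K) capEdges
    ≡⟨ map-++ (listed K) (layerEdges K ++ spokeEdges K) capEdges ⟨
  map (listed K) (edges K)
    ≡⟨ map-cong (listed≡vertices K) (edges K) ⟩
  map (vertices K) (edges K)
    ∎
  where
  open ≡-Reasoning
  layers : map layerTriple (map (2 +_) (upTo K)) ≡ map (listed K) (layerEdges K)
  layers = trans (sym (map-∘ (upTo K))) (map-∘ (upTo K))
  spokes : concatMap (λ q → concatMap (λ j → map (spokeTriple q j) [ 1 ⋯ 2 ]) [ 1 ⋯ 3 ])
                     (map (1 +_) (upTo K))
           ≡ map (listed K) (spokeEdges K)
  spokes = trans (concatMap-map _ (1 +_) (upTo K))
                 (sym (map-concatMap (listed K) (λ m → map (spokeEdge m) allSpokes) (upTo K)))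

vertices-injective : ∀ K {D D'} → vertices (suc K) D ≡ vertices (suc K) D' → D ≡ D'
vertices-injective K {D} {D'} eq =
  trans (sym (decode-vertices K D)) (trans (cong decode eq) (decode-vertices K D'))

_≟ᴱ_ : DecidableEquality Edge
_≟ᴱ_ = via-injection (mk↣ (vertices-injective 0)) (≡-dec _≟_)

_≟ˢ_ : DecidableEquality Spoke
_≟ˢ_ = via-injection (mk↣ {to = spokeEdge 0} λ { refl → refl }) _≟ᴱ_

_≟ᶜ_ : DecidableEquality Cap
_≟ᶜ_ = via-injection (mk↣ {to = capEdge} λ { refl → refl }) _≟ᴱ_

Valid : ℕ → Edge → Set
Valid K (layerEdge m)   = 1 ≤ m × m ≤ K
Valid K (spokeEdge m s) = m < K
Valid K (capEdge c)     = ⊤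

allSpokes-complete : ∀ s → s ∈ allSpokes
allSpokes-complete s₁₁ = here refl
allSpokes-complete s₁₂ = there (here refl)
allSpokes-complete s₂₁ = there (there (here refl))
allSpokes-complete s₂₂ = there (there (there (here refl)))
allSpokes-complete s₃₁ = there (there (there (there (here refl))))
allSpokes-complete s₃₂ = there (there (there (there (there (here refl)))))

allCaps-complete : ∀ c → c ∈ allCaps
allCaps-complete u₁₂  = here refl
allCaps-complete v₂₃  = there (here refl)
allCaps-complete u₁K₂ = there (there (here refl))
allCaps-complete v₂K₃ = there (there (there (here refl)))
allCaps-complete u₂K₁ = there (there (there (there (here refl))))
allCaps-complete v₃K₂ = there (there (there (there (there (here refl)))))

private
  module Spokes = UniqueDec _≟ˢ_
  module Caps = UniqueDec _≟ᶜ_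

allSpokes-unique : Unique allSpokes
allSpokes-unique = from-yes (Spokes.unique? allSpokes)

allCaps-unique : Unique allCaps
allCaps-unique = from-yes (Caps.unique? allCaps)

module _ {K : ℕ} where

  ∈layerEdges⁻ : ∀ {D} → D ∈ layerEdges K → ∃[ i ] i < K × D ≡ layerEdge (suc i)
  ∈layerEdges⁻ D∈ with i , i∈ , refl ← ∈-map⁻ (layerEdge ∘ suc) D∈ = i , ∈-upTo⁻ i∈ , refl

  ∈spokeEdges⁻ : ∀ {D} → D ∈ spokeEdges K → ∃₂ λ m s → m < K × D ≡ spokeEdge m s
  ∈spokeEdges⁻ D∈ with find (∈-concatMap⁻ (λ m → map (spokeEdge m) allSpokes) {xs = upTo K} D∈)
  ... | m , m∈ , D∈m with s , _ , refl ← ∈-map⁻ (spokeEdge m) D∈m = m , s , ∈-upTo⁻ m∈ , refl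

  ∈capEdges⁻ : ∀ {D} → D ∈ capEdges → ∃[ c ] D ≡ capEdge c
  ∈capEdges⁻ D∈ with c , _ , refl ← ∈-map⁻ capEdge D∈ = c , refl

  ∈edges⇒Valid : ∀ {D} → D ∈ edges K → Valid K D
  ∈edges⇒Valid D∈ with ∈-++⁻ (layerEdges K ++ spokeEdges K) D∈
  ... | inj₂ D∈c with c , refl ← ∈capEdges⁻ D∈c = tt
  ... | inj₁ D∈ls with ∈-++⁻ (layerEdges K) D∈ls
  ...   | inj₁ D∈l with i , i<K , refl ← ∈layerEdges⁻ D∈l = s≤s z≤n , i<K
  ...   | inj₂ D∈s with m , s , m<K , refl ← ∈spokeEdges⁻ D∈s = m<K

  Valid⇒∈edges : ∀ D → Valid K D → D ∈ edges K
  Valid⇒∈edges (layerEdge (suc i)) (_ , i<K) = ∈-++⁺ˡ (∈-++⁺ˡ (∈-map⁺ (layerEdge ∘ suc) (∈-upTo⁺ i<K)))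
  Valid⇒∈edges (spokeEdge m s) m<K = ∈-++⁺ˡ (∈-++⁺ʳ (layerEdges K)
    (∈-concatMap⁺ (λ m → map (spokeEdge m) allSpokes)
                  (lose (∈-upTo⁺ m<K) (∈-map⁺ (spokeEdge m) (allSpokes-complete s)))))
  Valid⇒∈edges (capEdge c) _ = ∈-++⁺ʳ (layerEdges K ++ spokeEdges K) (∈-map⁺ capEdge (allCaps-complete c))

  edges-unique : Unique (edges K)
  edges-unique = ++⁺ (++⁺ layers-unique spokes-unique layers#spokes) caps-unique layers+spokes#caps
    where
    layers-unique : Unique (layerEdges K)
    layers-unique = map⁺ (λ { refl → refl }) (upTo⁺ K)

    blocks-apart : ∀ {m m'} → m ≢ m' → Disjoint (map (spokeEdge m) allSpokes) (map (spokeEdge m') allSpokes)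
    blocks-apart {m} {m'} m≢m' (D∈ , D∈')
      with _ , _ , refl ← ∈-map⁻ (spokeEdge m) D∈ | _ , _ , refl ← ∈-map⁻ (spokeEdge m') D∈' = m≢m' refl

    spokes-unique : Unique (spokeEdges K)
    spokes-unique =
      concat⁺ (All.map⁺ (All.universal block-unique (upTo K))) (AllPairs.map⁺ (AllPairs.map blocks-apart (upTo⁺ K)))
      where
      block-unique : ∀ m → Unique (map (spokeEdge m) allSpokes)
      block-unique m = map⁺ {f = spokeEdge m} (λ { refl → refl }) allSpokes-unique

    caps-unique : Unique capEdges
    caps-unique = map⁺ {f = capEdge} (λ { refl → refl }) allCaps-unique

    layers#spokes : Disjoint (layerEdges K) (spokeEdges K)
    layers#spokes (D∈l , D∈s) with _ , _ , refl ← ∈layerEdges⁻ D∈l | _ , _ , _ , () ← ∈spokeEdges⁻ D∈s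

    layers+spokes#caps : Disjoint (layerEdges K ++ spokeEdges K) capEdges
    layers+spokes#caps (D∈ls , D∈c) with c , refl ← ∈capEdges⁻ D∈c | ∈-++⁻ (layerEdges K) D∈ls
    ... | inj₁ D∈l with _ , _ , () ← ∈layerEdges⁻ D∈l
    ... | inj₂ D∈s with _ , _ , _ , () ← ∈spokeEdges⁻ D∈s

lookup-injective : ∀ {A : Set} {xs : List A} → Unique xs → ∀ {i j} → lookup xs i ≡ lookup xs j → i ≡ j
lookup-injective {xs = _ ∷ _} _ {fzero} {fzero} _ = refl
lookup-injective {xs = _ ∷ _} (x∉ ∷ _) {fzero} {fsuc j} eq = ⊥-elim (All.lookup x∉ (∈-lookup j) eq)
lookup-injective {xs = _ ∷ _} (x∉ ∷ _) {fsuc i} {fzero} eq = ⊥-elim (All.lookup x∉ (∈-lookup i) (sym eq))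
lookup-injective {xs = _ ∷ _} (_ ∷ u) {fsuc i} {fsuc j} eq = cong fsuc (lookup-injective u eq)

-- Proper edges in terms of the colours of the layers

private
  0<1 : 0 < 1
  0<1 = s≤s z≤n
  1<2 : 1 < 2
  1<2 = s≤s (s≤s z≤n)
  0<3 : 0 < 3
  0<3 = s≤s z≤n
  1<3 : 1 < 3
  1<3 = s≤s (s≤s z≤n)
  2<3 : 2 < 3
  2<3 = s≤s (s≤s (s≤s z≤n))

TwoColouredOn : (ℕ → ℕ) → List ℕ → Set
TwoColouredOn G (x ∷ y ∷ z ∷ []) = TwoColoured (G x) (G y) (G z)
TwoColouredOn G _                = ⊥

module _ (n : ℕ) (G : ℕ → ℕ) {a b c : ℕ} (a<b : a < b) (b<c : b < c) (c<n : c < n) where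

  properOn⇔-abc : ProperOn (G ∘ toℕ) (toSubset n (a ∷ b ∷ c ∷ [])) ⇔ TwoColouredOn G (a ∷ b ∷ c ∷ [])
  properOn⇔-abc = properOn⇔twoColoured n G a<b b<c c<n _ ↭-refl

  properOn⇔-cab : ProperOn (G ∘ toℕ) (toSubset n (c ∷ a ∷ b ∷ [])) ⇔ TwoColouredOn G (c ∷ a ∷ b ∷ [])
  properOn⇔-cab = mk⇔ (twoColoured-swap₁₂ ∘ twoColoured-swap₂₃) (twoColoured-swap₂₃ ∘ twoColoured-swap₁₂)
    ⇔-∘ properOn⇔twoColoured n G a<b b<c c<n _ (↭-trans (swap c a ↭-refl) (prep a (swap c b ↭-refl)))

  properOn⇔-cba : ProperOn (G ∘ toℕ) (toSubset n (c ∷ b ∷ a ∷ [])) ⇔ TwoColouredOn G (c ∷ b ∷ a ∷ [])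
  properOn⇔-cba = mk⇔ twoColoured-swap₁₃ twoColoured-swap₁₃
    ⇔-∘ properOn⇔twoColoured n G a<b b<c c<n _
          (↭-trans (swap c b ↭-refl) (↭-trans (prep b (swap c a ↭-refl)) (swap b a ↭-refl)))

vertex-<-position : ∀ m {r r'} → r < r' → vertex m r < vertex m r'
vertex-<-position m r<r' = s≤s (s≤s (+-monoʳ-< (m * 3) r<r'))

vertex-<-layer : ∀ m {r} r' → r < 3 → vertex m r < vertex (suc m) r'
vertex-<-layer m {r} r' r<3 = s≤s (s≤s (begin-strict
  m * 3 + r        <⟨ +-monoʳ-< (m * 3) r<3 ⟩
  m * 3 + 3        ≡⟨ +-comm (m * 3) 3 ⟩
  suc m * 3        ≤⟨ m≤m+n (suc m * 3) r' ⟩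
  suc m * 3 + r'   ∎))
  where open ≤-Reasoning

vertex-<-last : ∀ {K} → 1 ≤ K → ∀ {r} r' → r < 3 → vertex 0 r < vertex K r'
vertex-<-last {suc K} _ {r} r' r<3 = s≤s (s≤s (≤-trans r<3 (≤-trans (m≤m+n 3 (K * 3)) (m≤m+n _ r'))))

vertex<count : ∀ {K m r} → m ≤ K → r < 3 → vertex m r < 2 + 3 * suc K
vertex<count {K} {m} {r} m≤K r<3 = s≤s (s≤s (begin-strict
  m * 3 + r     <⟨ +-monoʳ-< (m * 3) r<3 ⟩
  m * 3 + 3     ≡⟨ +-comm (m * 3) 3 ⟩
  suc m * 3     ≤⟨ *-monoˡ-≤ 3 (s≤s m≤K) ⟩
  suc K * 3     ≡⟨ *-comm (suc K) 3 ⟩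
  3 * suc K     ∎))
  where open ≤-Reasoning

hub<rim⊎rim<hub : ∀ s → hub s < rim s ⊎ rim s < hub s
hub<rim⊎rim<hub s₁₁ = inj₁ (s≤s z≤n)
hub<rim⊎rim<hub s₁₂ = inj₁ (s≤s z≤n)
hub<rim⊎rim<hub s₂₁ = inj₁ (s≤s (s≤s z≤n))
hub<rim⊎rim<hub s₂₂ = inj₂ (s≤s z≤n)
hub<rim⊎rim<hub s₃₁ = inj₂ (s≤s z≤n)
hub<rim⊎rim<hub s₃₂ = inj₂ (s≤s (s≤s z≤n))

properOn⇔twoColouredOn : ∀ {K} → 1 ≤ K → ∀ D → Valid K D → ∀ G →
  ProperOn (G ∘ toℕ) (toSubset (2 + 3 * suc K) (vertices K D)) ⇔ TwoColouredOn G (vertices K D)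
properOn⇔twoColouredOn {K} _ (layerEdge m) (_ , m≤K) G =
  properOn⇔-abc _ G (vertex-<-position m 0<1) (vertex-<-position m 1<2) (vertex<count m≤K 2<3)
properOn⇔twoColouredOn {K} _ (spokeEdge m s) m<K G with hub<rim⊎rim<hub s
... | inj₁ h<r = properOn⇔-cab _ G (vertex-<-position m h<r) (vertex-<-layer m (hub s) (rim<3 s))
                               (vertex<count m<K (hub<3 s))
... | inj₂ r<h = properOn⇔-cba _ G (vertex-<-position m r<h) (vertex-<-layer m (hub s) (hub<3 s))
                               (vertex<count m<K (hub<3 s))
properOn⇔twoColouredOn {K} 1≤K (capEdge u₁₂) _ G =
  properOn⇔-abc _ G (s≤s z≤n) (vertex-<-position 0 0<1) (vertex<count {K} z≤n 1<3)
properOn⇔twoColouredOn {K} 1≤K (capEdge v₂₃) _ G =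
  properOn⇔-abc _ G (s≤s (s≤s z≤n)) (vertex-<-position 0 1<2) (vertex<count {K} z≤n 2<3)
properOn⇔twoColouredOn {K} 1≤K (capEdge u₁K₂) _ G =
  properOn⇔-abc _ G (s≤s z≤n) (vertex-<-last 1≤K 1 0<3) (vertex<count {K} ≤-refl 1<3)
properOn⇔twoColouredOn {K} 1≤K (capEdge v₂K₃) _ G =
  properOn⇔-abc _ G (s≤s (s≤s z≤n)) (vertex-<-last 1≤K 2 1<3) (vertex<count {K} ≤-refl 2<3)
properOn⇔twoColouredOn {K} 1≤K (capEdge u₂K₁) _ G =
  properOn⇔-abc _ G (s≤s z≤n) (vertex-<-last 1≤K 0 1<3) (vertex<count {K} ≤-refl 0<3)
properOn⇔twoColouredOn {K} 1≤K (capEdge v₃K₂) _ G =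
  properOn⇔-abc _ G (s≤s (s≤s z≤n)) (vertex-<-last 1≤K 1 2<3) (vertex<count {K} ≤-refl 1<3)

at : Triple → ℕ → ℕ
at X 0 = c₀ X
at X 1 = c₁ X
at X _ = c₂ X

SpokeColoured : Triple → Triple → Spoke → Set
SpokeColoured X Y s = TwoColoured (at Y (hub s)) (at X (hub s)) (at X (rim s))

CapColoured : ℕ → ℕ → Triple → Triple → Cap → Set
CapColoured u v X Z u₁₂  = TwoColoured u (c₀ X) (c₁ X)
CapColoured u v X Z v₂₃  = TwoColoured v (c₁ X) (c₂ X)
CapColoured u v X Z u₁K₂ = TwoColoured u (c₀ X) (c₁ Z)
CapColoured u v X Z v₂K₃ = TwoColoured v (c₁ X) (c₂ Z)
CapColoured u v X Z u₂K₁ = TwoColoured u (c₁ X) (c₀ Z)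
CapColoured u v X Z v₃K₂ = TwoColoured v (c₂ X) (c₁ Z)

EdgeColoured : ℕ → ℕ → (ℕ → Triple) → ℕ → Edge → Set
EdgeColoured u v L K (layerEdge m)   = TwoColouredᵗ (L m)
EdgeColoured u v L K (spokeEdge m s) = SpokeColoured (L m) (L (suc m)) s
EdgeColoured u v L K (capEdge c)     = CapColoured u v (L 0) (L K) c

twoColouredOn≡edgeColoured : ∀ (G : ℕ → ℕ) (L : ℕ → Triple) →
  (∀ m r → r < 3 → G (vertex m r) ≡ at (L m) r) →
  ∀ K D → TwoColouredOn G (vertices K D) ≡ EdgeColoured (G 0) (G 1) L K D
twoColouredOn≡edgeColoured G L agree K (layerEdge m)
  rewrite agree m 0 0<3 | agree m 1 1<3 | agree m 2 2<3 = refl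
twoColouredOn≡edgeColoured G L agree K (spokeEdge m s)
  rewrite agree (suc m) (hub s) (hub<3 s) | agree m (hub s) (hub<3 s) | agree m (rim s) (rim<3 s) = refl
twoColouredOn≡edgeColoured G L agree K (capEdge u₁₂)  rewrite agree 0 0 0<3 | agree 0 1 1<3 = refl
twoColouredOn≡edgeColoured G L agree K (capEdge v₂₃)  rewrite agree 0 1 1<3 | agree 0 2 2<3 = refl
twoColouredOn≡edgeColoured G L agree K (capEdge u₁K₂) rewrite agree 0 0 0<3 | agree K 1 1<3 = refl
twoColouredOn≡edgeColoured G L agree K (capEdge v₂K₃) rewrite agree 0 1 1<3 | agree K 2 2<3 = refl
twoColouredOn≡edgeColoured G L agree K (capEdge u₂K₁) rewrite agree 0 1 1<3 | agree K 0 0<3 = refl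
twoColouredOn≡edgeColoured G L agree K (capEdge v₃K₂) rewrite agree 0 2 2<3 | agree K 1 1<3 = refl

layered : ℕ → ℕ → (ℕ → Triple) → ℕ → ℕ
layered u v L 0             = u
layered u v L 1             = v
layered u v L (suc (suc n)) = at (L (quot3 n)) (rem3 n)

layered-vertex : ∀ u v L m r → r < 3 → layered u v L (vertex m r) ≡ at (L m) r
layered-vertex u v L m r r<3 rewrite quot3-*3+ m r<3 | rem3-*3+ m r<3 = refl

-- Colourings of H minus one edge

spokeColoured? : ∀ X Y s → Dec (SpokeColoured X Y s)
spokeColoured? X Y s = twoColoured? _ _ _

capColoured? : ∀ u v X Z c → Dec (CapColoured u v X Z c)
capColoured? u v X Z u₁₂  = twoColoured? _ _ _
capColoured? u v X Z v₂₃  = twoColoured? _ _ _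
capColoured? u v X Z u₁K₂ = twoColoured? _ _ _
capColoured? u v X Z v₂K₃ = twoColoured? _ _ _
capColoured? u v X Z u₂K₁ = twoColoured? _ _ _
capColoured? u v X Z v₃K₂ = twoColoured? _ _ _

record Checked (exempt : Bool) {P : Set} (P? : Dec P) : Set where
  field
    certificate : if exempt then ⊤ else True P?

checked : ∀ {exempt} {P : Set} {P? : Dec P} → exempt ≢ true → Checked exempt P? → P
checked {false} _    c = toWitness (Checked.certificate c)
checked {true}  kept _ = ⊥-elim (kept refl)

AllSpokes : (Spoke → Set) → Set
AllSpokes P = P s₁₁ × P s₁₂ × P s₂₁ × P s₂₂ × P s₃₁ × P s₃₂

allSpokes-lookup : ∀ {P} → AllSpokes P → ∀ s → P s
allSpokes-lookup (p , _ , _ , _ , _ , _) s₁₁ = p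
allSpokes-lookup (_ , p , _ , _ , _ , _) s₁₂ = p
allSpokes-lookup (_ , _ , p , _ , _ , _) s₂₁ = p
allSpokes-lookup (_ , _ , _ , p , _ , _) s₂₂ = p
allSpokes-lookup (_ , _ , _ , _ , p , _) s₃₁ = p
allSpokes-lookup (_ , _ , _ , _ , _ , p) s₃₂ = p

AllCaps : (Cap → Set) → Set
AllCaps P = P u₁₂ × P v₂₃ × P u₁K₂ × P v₂K₃ × P u₂K₁ × P v₃K₂

allCaps-lookup : ∀ {P} → AllCaps P → ∀ c → P c
allCaps-lookup (p , _ , _ , _ , _ , _) u₁₂  = p
allCaps-lookup (_ , p , _ , _ , _ , _) v₂₃  = p
allCaps-lookup (_ , _ , p , _ , _ , _) u₁K₂ = p
allCaps-lookup (_ , _ , _ , p , _ , _) v₂K₃ = p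
allCaps-lookup (_ , _ , _ , _ , p , _) u₂K₁ = p
allCaps-lookup (_ , _ , _ , _ , _ , p) v₃K₂ = p

LayerCheck : Bool → Triple → Set
LayerCheck exempt X = Checked exempt (twoColoured? (c₀ X) (c₁ X) (c₂ X))

record SpokesCheck (exempt : Spoke → Bool) (X Y : Triple) : Set where
  field
    certificates : AllSpokes λ s → Checked (exempt s) (spokeColoured? X Y s)

record CapsCheck (exempt : Cap → Bool) (u v : ℕ) (X Z : Triple) : Set where
  field
    certificates : AllCaps λ c → Checked (exempt c) (capColoured? u v X Z c)

odd : ℕ → Bool
odd zero    = false
odd (suc n) = not (odd n)

-- Layer 0 is coloured `first`, layer d (the defect) `defect`; the layers strictly between use
-- `below`, those after d use `above`, both alternating with the parity of the layer.
record Scheme : Set where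
  constructor scheme
  field
    first below₀ below₁ defect above₀ above₁ : Triple
    colourU colourV : ℕ

  below above : Bool → Triple
  below b = if b then below₁ else below₀
  above b = if b then above₁ else above₀
open Scheme

layerColour : Scheme → ℕ → ℕ → Triple
layerColour σ d zero = first σ
layerColour σ d (suc m) with <-cmp (suc m) d
... | tri< _ _ _ = below σ (odd (suc m))
... | tri≈ _ _ _ = defect σ
... | tri> _ _ _ = above σ (odd (suc m))

data Removed : Set where
  removedLayer : Removed
  removedSpoke : Spoke → Removed
  removedCap   : Cap → Removed

-- The defect layer d is the removed layer, or the layer the removed spoke enters; d = 1 for a cap.
removedEdge : Removed → ℕ → Edge
removedEdge removedLayer     d = layerEdge d
removedEdge (removedSpoke s) d = spokeEdge (pred d) s
removedEdge (removedCap c)   d = capEdge c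

isRemovedLayer : Removed → Bool
isRemovedLayer removedLayer = true
isRemovedLayer _            = false

isRemovedSpoke : Removed → Spoke → Bool
isRemovedSpoke (removedSpoke s) s' = isYes (s ≟ˢ s')
isRemovedSpoke _                _  = false

isRemovedCap : Removed → Cap → Bool
isRemovedCap (removedCap c) c' = isYes (c ≟ᶜ c')
isRemovedCap _              _  = false

-- b is the parity of the defect layer
record Fits (σ : Scheme) (r : Removed) (b : Bool) : Set where
  field
    below₀-layer  : LayerCheck false (below₀ σ)
    below₁-layer  : LayerCheck false (below₁ σ)
    defect-layer  : LayerCheck (isRemovedLayer r) (defect σ)
    above₀-layer  : LayerCheck false (above₀ σ)
    above₁-layer  : LayerCheck false (above₁ σ)
    first→below   : SpokesCheck (const false) (first σ) (below₁ σ)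
    first→defect  : SpokesCheck (λ s → not b ∨ isRemovedSpoke r s) (first σ) (defect σ)
    below₀→below₁ : SpokesCheck (const false) (below₀ σ) (below₁ σ)
    below₁→below₀ : SpokesCheck (const false) (below₁ σ) (below₀ σ)
    below→defect  : SpokesCheck (isRemovedSpoke r) (below σ (not b)) (defect σ)
    defect→above  : SpokesCheck (const false) (defect σ) (above σ (not b))
    above₀→above₁ : SpokesCheck (const false) (above₀ σ) (above₁ σ)
    above₁→above₀ : SpokesCheck (const false) (above₁ σ) (above₀ σ)
    caps-above    : CapsCheck (isRemovedCap r) (colourU σ) (colourV σ) (first σ) (above₁ σ)
    caps-defect   : CapsCheck (λ c → not b ∨ isRemovedCap r c) (colourU σ) (colourV σ) (first σ) (defect σ)

isRemovedLayer-sound : ∀ {r} d → isRemovedLayer r ≡ true → removedEdge r d ≡ layerEdge d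
isRemovedLayer-sound {removedLayer} d _ = refl

isRemovedSpoke-sound : ∀ {r} d s → isRemovedSpoke r s ≡ true → removedEdge r d ≡ spokeEdge (pred d) s
isRemovedSpoke-sound {removedSpoke s'} d s e =
  cong (spokeEdge (pred d)) (toWitness {a? = s' ≟ˢ s} (subst T (sym e) tt))

isRemovedCap-sound : ∀ {r} d c → isRemovedCap r c ≡ true → removedEdge r d ≡ capEdge c
isRemovedCap-sound {removedCap c'} d c e =
  cong capEdge (toWitness {a? = c' ≟ᶜ c} (subst T (sym e) tt))

private
  spokes : ∀ {exempt X Y} → SpokesCheck exempt X Y → ∀ s → exempt s ≢ true → SpokeColoured X Y s
  spokes {exempt} {X} {Y} check s kept =
    checked kept (allSpokes-lookup {λ s → Checked (exempt s) (spokeColoured? X Y s)}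
                                   (SpokesCheck.certificates check) s)

  caps : ∀ {exempt u v X Z} → CapsCheck exempt u v X Z → ∀ c → exempt c ≢ true → CapColoured u v X Z c
  caps {exempt} {u} {v} {X} {Z} check c kept =
    checked kept (allCaps-lookup {λ c → Checked (exempt c) (capColoured? u v X Z c)}
                                 (CapsCheck.certificates check) c)

module _ {σ : Scheme} {r : Removed} {b : Bool} (fits : Fits σ r b) where
  open Fits fits

  below-twoColoured : ∀ p → TwoColouredᵗ (below σ p)
  below-twoColoured false = checked (λ ()) below₀-layer
  below-twoColoured true  = checked (λ ()) below₁-layer

  above-twoColoured : ∀ p → TwoColouredᵗ (above σ p)
  above-twoColoured false = checked (λ ()) above₀-layer
  above-twoColoured true  = checked (λ ()) above₁-layer

  defect-twoColoured : isRemovedLayer r ≢ true → TwoColouredᵗ (defect σ)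
  defect-twoColoured kept = checked kept defect-layer

  below-link : ∀ p s → SpokeColoured (below σ p) (below σ (not p)) s
  below-link false s = spokes below₀→below₁ s (λ ())
  below-link true  s = spokes below₁→below₀ s (λ ())

  above-link : ∀ p s → SpokeColoured (above σ p) (above σ (not p)) s
  above-link false s = spokes above₀→above₁ s (λ ())
  above-link true  s = spokes above₁→above₀ s (λ ())

  first-link-below : ∀ s → SpokeColoured (first σ) (below₁ σ) s
  first-link-below s = spokes first→below s (λ ())

  first-link-defect : b ≡ true → ∀ s → isRemovedSpoke r s ≢ true → SpokeColoured (first σ) (defect σ) s
  first-link-defect refl = spokes first→defect

  below-link-defect : ∀ s → isRemovedSpoke r s ≢ true → SpokeColoured (below σ (not b)) (defect σ) s
  below-link-defect = spokes below→defect

  defect-link-above : ∀ s → SpokeColoured (defect σ) (above σ (not b)) s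
  defect-link-above s = spokes defect→above s (λ ())

  caps-above-coloured : ∀ c → isRemovedCap r c ≢ true →
                        CapColoured (colourU σ) (colourV σ) (first σ) (above₁ σ) c
  caps-above-coloured = caps caps-above

  caps-defect-coloured : b ≡ true → ∀ c → isRemovedCap r c ≢ true →
                         CapColoured (colourU σ) (colourV σ) (first σ) (defect σ) c
  caps-defect-coloured refl = caps caps-defect

module _ {σ : Scheme} {r : Removed} where

  layer-sound : ∀ d → Fits σ r (odd d) → ∀ m → 1 ≤ m → layerEdge m ≢ removedEdge r d →
                TwoColouredᵗ (layerColour σ d m)
  layer-sound d fits (suc m) _ kept with <-cmp (suc m) d
  ... | tri< _ _ _    = below-twoColoured fits (odd (suc m))
  ... | tri≈ _ refl _ = defect-twoColoured fits (kept ∘ sym ∘ isRemovedLayer-sound d)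
  ... | tri> _ _ _    = above-twoColoured fits (odd (suc m))

  spoke-sound : ∀ d → Fits σ r (odd d) → 1 ≤ d → ∀ m s → spokeEdge m s ≢ removedEdge r d →
                SpokeColoured (layerColour σ d m) (layerColour σ d (suc m)) s
  spoke-sound d fits 1≤d zero s kept with <-cmp 1 d
  ... | tri< _ _ _    = first-link-below fits s
  ... | tri≈ _ refl _ = first-link-defect fits refl s (kept ∘ sym ∘ isRemovedSpoke-sound d s)
  ... | tri> _ _ 1>d  = ⊥-elim (<⇒≱ 1>d 1≤d)
  spoke-sound d fits 1≤d (suc m) s kept with <-cmp (suc m) d
  ... | tri≈ _ refl _ with <-cmp (suc (suc m)) (suc m)
  ...   | tri> _ _ _   = defect-link-above fits s
  ...   | tri< _ _ m+2≯m+1 = ⊥-elim (m+2≯m+1 (n<1+n _))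
  ...   | tri≈ _ _ m+2≯m+1 = ⊥-elim (m+2≯m+1 (n<1+n _))
  spoke-sound d fits 1≤d (suc m) s kept | tri< m+1<d _ _ with <-cmp (suc (suc m)) d
  ...   | tri< _ _ _    = below-link fits (odd (suc m)) s
  ...   | tri≈ _ refl _ = subst (λ p → SpokeColoured (below σ p) (defect σ) s) (not-involutive (odd (suc m)))
                            (below-link-defect fits s (kept ∘ sym ∘ isRemovedSpoke-sound d s))
  ...   | tri> _ _ d<m+2 = ⊥-elim (<⇒≱ m+1<d (≤-pred d<m+2))
  spoke-sound d fits 1≤d (suc m) s kept | tri> _ _ d<m+1 with <-cmp (suc (suc m)) d
  ...   | tri> _ _ _       = above-link fits (odd (suc m)) s
  ...   | tri< _ _ d≮m+2   = ⊥-elim (d≮m+2 (<-trans d<m+1 (n<1+n _)))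
  ...   | tri≈ _ _ d≮m+2   = ⊥-elim (d≮m+2 (<-trans d<m+1 (n<1+n _)))

  cap-sound : ∀ d K → Fits σ r (odd d) → d ≤ suc K → odd (suc K) ≡ true → ∀ c → capEdge c ≢ removedEdge r d →
              CapColoured (colourU σ) (colourV σ) (layerColour σ d 0) (layerColour σ d (suc K)) c
  cap-sound d K fits d≤K+1 K+1-odd c kept with <-cmp (suc K) d
  ... | tri< K+1<d _ _ = ⊥-elim (<⇒≱ K+1<d d≤K+1)
  ... | tri≈ _ refl _  = caps-defect-coloured fits K+1-odd c (kept ∘ sym ∘ isRemovedCap-sound d c)
  ... | tri> _ _ _ rewrite K+1-odd = caps-above-coloured fits c (kept ∘ sym ∘ isRemovedCap-sound d c)

  scheme-sound : ∀ d K → Fits σ r (odd d) → 1 ≤ d → d ≤ suc K → odd (suc K) ≡ true →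
                 ∀ D → Valid (suc K) D → D ≢ removedEdge r d →
                 EdgeColoured (colourU σ) (colourV σ) (layerColour σ d) (suc K) D
  scheme-sound d K fits 1≤d _     _     (layerEdge m)   (1≤m , _) = layer-sound d fits m 1≤m
  scheme-sound d K fits 1≤d _     _     (spokeEdge m s) _         = spoke-sound d fits 1≤d m s
  scheme-sound d K fits _   d≤K+1 K+1-odd (capEdge c)   _         = cap-sound d K fits d≤K+1 K+1-odd c

layerScheme : Bool → Scheme
layerScheme false = scheme ⟨ 0 , 1 , 0 ⟩ ⟨ 0 , 1 , 0 ⟩ ⟨ 1 , 0 , 1 ⟩ ⟨ 0 , 0 , 0 ⟩ ⟨ 2 , 1 , 2 ⟩ ⟨ 1 , 2 , 1 ⟩ 0 0
layerScheme true  = scheme ⟨ 0 , 1 , 0 ⟩ ⟨ 0 , 1 , 0 ⟩ ⟨ 1 , 0 , 1 ⟩ ⟨ 1 , 1 , 1 ⟩ ⟨ 2 , 0 , 2 ⟩ ⟨ 0 , 2 , 0 ⟩ 0 0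

spokeScheme : Spoke → Bool → Scheme
spokeScheme s₁₁ false = scheme ⟨ 1 , 1 , 1 ⟩ ⟨ 0 , 2 , 0 ⟩ ⟨ 2 , 0 , 2 ⟩ ⟨ 1 , 0 , 0 ⟩ ⟨ 1 , 0 , 0 ⟩ ⟨ 0 , 1 , 1 ⟩ 0 0
spokeScheme s₁₁ true  = scheme ⟨ 1 , 0 , 1 ⟩ ⟨ 1 , 0 , 1 ⟩ ⟨ 0 , 1 , 0 ⟩ ⟨ 2 , 0 , 0 ⟩ ⟨ 0 , 2 , 2 ⟩ ⟨ 2 , 0 , 0 ⟩ 0 1
spokeScheme s₁₂ false = scheme ⟨ 0 , 1 , 0 ⟩ ⟨ 0 , 1 , 0 ⟩ ⟨ 1 , 0 , 1 ⟩ ⟨ 1 , 0 , 0 ⟩ ⟨ 1 , 0 , 0 ⟩ ⟨ 0 , 1 , 1 ⟩ 0 0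
spokeScheme s₁₂ true  = scheme ⟨ 0 , 1 , 0 ⟩ ⟨ 0 , 1 , 0 ⟩ ⟨ 1 , 0 , 1 ⟩ ⟨ 0 , 1 , 1 ⟩ ⟨ 1 , 0 , 0 ⟩ ⟨ 0 , 1 , 1 ⟩ 0 0
spokeScheme s₂₁ false = scheme ⟨ 0 , 1 , 1 ⟩ ⟨ 0 , 1 , 1 ⟩ ⟨ 1 , 0 , 0 ⟩ ⟨ 0 , 0 , 1 ⟩ ⟨ 0 , 0 , 1 ⟩ ⟨ 1 , 1 , 0 ⟩ 0 0
spokeScheme s₂₁ true  = scheme ⟨ 0 , 1 , 1 ⟩ ⟨ 0 , 1 , 1 ⟩ ⟨ 1 , 0 , 0 ⟩ ⟨ 0 , 1 , 0 ⟩ ⟨ 1 , 0 , 1 ⟩ ⟨ 0 , 1 , 0 ⟩ 0 0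
spokeScheme s₂₂ false = scheme ⟨ 1 , 1 , 0 ⟩ ⟨ 1 , 1 , 0 ⟩ ⟨ 0 , 0 , 1 ⟩ ⟨ 1 , 0 , 0 ⟩ ⟨ 1 , 0 , 0 ⟩ ⟨ 0 , 1 , 1 ⟩ 0 0
spokeScheme s₂₂ true  = scheme ⟨ 1 , 1 , 0 ⟩ ⟨ 1 , 1 , 0 ⟩ ⟨ 0 , 0 , 1 ⟩ ⟨ 0 , 1 , 0 ⟩ ⟨ 1 , 0 , 1 ⟩ ⟨ 0 , 1 , 0 ⟩ 0 0
spokeScheme s₃₁ false = scheme ⟨ 0 , 1 , 0 ⟩ ⟨ 0 , 1 , 0 ⟩ ⟨ 1 , 0 , 1 ⟩ ⟨ 0 , 0 , 1 ⟩ ⟨ 0 , 0 , 1 ⟩ ⟨ 1 , 1 , 0 ⟩ 0 0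
spokeScheme s₃₁ true  = scheme ⟨ 0 , 1 , 0 ⟩ ⟨ 0 , 1 , 0 ⟩ ⟨ 1 , 0 , 1 ⟩ ⟨ 1 , 1 , 0 ⟩ ⟨ 0 , 0 , 1 ⟩ ⟨ 1 , 1 , 0 ⟩ 0 0
spokeScheme s₃₂ false = scheme ⟨ 1 , 1 , 1 ⟩ ⟨ 0 , 2 , 0 ⟩ ⟨ 2 , 0 , 2 ⟩ ⟨ 0 , 0 , 1 ⟩ ⟨ 0 , 0 , 1 ⟩ ⟨ 1 , 1 , 0 ⟩ 0 0
spokeScheme s₃₂ true  = scheme ⟨ 0 , 1 , 0 ⟩ ⟨ 0 , 1 , 0 ⟩ ⟨ 1 , 0 , 1 ⟩ ⟨ 1 , 1 , 2 ⟩ ⟨ 2 , 2 , 1 ⟩ ⟨ 1 , 1 , 2 ⟩ 0 1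

capScheme : Cap → Scheme
capScheme u₁₂  = scheme ⟨ 0 , 0 , 0 ⟩ ⟨ 1 , 2 , 2 ⟩ ⟨ 2 , 1 , 1 ⟩ ⟨ 2 , 1 , 1 ⟩ ⟨ 1 , 2 , 2 ⟩ ⟨ 2 , 1 , 1 ⟩ 0 1
capScheme v₂₃  = scheme ⟨ 1 , 1 , 1 ⟩ ⟨ 2 , 2 , 0 ⟩ ⟨ 0 , 0 , 2 ⟩ ⟨ 0 , 0 , 2 ⟩ ⟨ 2 , 2 , 0 ⟩ ⟨ 0 , 0 , 2 ⟩ 0 1
capScheme u₁K₂ = scheme ⟨ 0 , 1 , 1 ⟩ ⟨ 0 , 1 , 1 ⟩ ⟨ 1 , 0 , 0 ⟩ ⟨ 1 , 0 , 0 ⟩ ⟨ 0 , 1 , 1 ⟩ ⟨ 1 , 0 , 0 ⟩ 0 0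
capScheme v₂K₃ = scheme ⟨ 1 , 1 , 1 ⟩ ⟨ 2 , 2 , 0 ⟩ ⟨ 0 , 0 , 2 ⟩ ⟨ 0 , 0 , 2 ⟩ ⟨ 2 , 2 , 0 ⟩ ⟨ 0 , 0 , 2 ⟩ 0 0
capScheme u₂K₁ = scheme ⟨ 1 , 1 , 1 ⟩ ⟨ 0 , 2 , 2 ⟩ ⟨ 2 , 0 , 0 ⟩ ⟨ 2 , 0 , 0 ⟩ ⟨ 0 , 2 , 2 ⟩ ⟨ 2 , 0 , 0 ⟩ 0 0
capScheme v₃K₂ = scheme ⟨ 1 , 1 , 0 ⟩ ⟨ 1 , 1 , 0 ⟩ ⟨ 0 , 0 , 1 ⟩ ⟨ 0 , 0 , 1 ⟩ ⟨ 1 , 1 , 0 ⟩ ⟨ 0 , 0 , 1 ⟩ 0 0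

-- Each certificate is found by evaluation.
layerScheme-fits : ∀ b → Fits (layerScheme b) removedLayer b
layerScheme-fits false = _
layerScheme-fits true  = _

spokeScheme-fits : ∀ s b → Fits (spokeScheme s b) (removedSpoke s) b
spokeScheme-fits s₁₁ false = _
spokeScheme-fits s₁₁ true  = _
spokeScheme-fits s₁₂ false = _
spokeScheme-fits s₁₂ true  = _
spokeScheme-fits s₂₁ false = _
spokeScheme-fits s₂₁ true  = _
spokeScheme-fits s₂₂ false = _
spokeScheme-fits s₂₂ true  = _
spokeScheme-fits s₃₁ false = _
spokeScheme-fits s₃₁ true  = _
spokeScheme-fits s₃₂ false = _
spokeScheme-fits s₃₂ true  = _

capScheme-fits : ∀ c → Fits (capScheme c) (removedCap c) true
capScheme-fits u₁₂  = _
capScheme-fits v₂₃  = _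
capScheme-fits u₁K₂ = _
capScheme-fits v₂K₃ = _
capScheme-fits u₂K₁ = _
capScheme-fits v₃K₂ = _

-- H for k = T + 1; layers are numbered from 0, so layer K = 2k - 1 is V_{2k}.
module Construction (T : ℕ) where

  K : ℕ
  K = suc (T + T)

  n : ℕ
  n = 2 + 3 * suc K

  H : BiHypergraph
  H = fromLists n (edgeList K)

  1≤K : 1 ≤ K
  1≤K = s≤s z≤n

  K-odd : odd K ≡ true
  K-odd = cong not (even T)
    where
    even : ∀ t → odd (t + t) ≡ false
    even zero    = refl
    even (suc t) rewrite +-suc t t | even t = refl

  vertices∈edgeList : ∀ D → Valid K D → vertices K D ∈ edgeList K
  vertices∈edgeList D v = subst (vertices K D ∈_) (sym (edgeList≡ K)) (∈-map⁺ (vertices K) (Valid⇒∈edges D v))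

  edgeIndex : ∀ D → Valid K D → Fin (nE H)
  edgeIndex D v = Any.index (vertices∈edgeList D v)

  edge-edgeIndex : ∀ D v → edge H (edgeIndex D v) ≡ toSubset n (vertices K D)
  edge-edgeIndex D v = cong (toSubset n) (sym (lookup-index (vertices∈edgeList D v)))

  lookup-edgeList : ∀ i → ∃[ D ] Valid K D × lookup (edgeList K) i ≡ vertices K D
  lookup-edgeList i
    with D , D∈ , eq ← ∈-map⁻ (vertices K) (subst (lookup (edgeList K) i ∈_) (edgeList≡ K) (∈-lookup i))
    = D , ∈edges⇒Valid {K} D∈ , eq

  edgeList-unique : Unique (edgeList K)
  edgeList-unique = subst Unique (sym (edgeList≡ K)) (map⁺ (vertices-injective (T + T)) (edges-unique {K}))

  extend : (Fin n → ℕ) → ℕ → ℕ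
  extend f y with y <? n
  ... | yes y<n = f (fromℕ< y<n)
  ... | no  _   = 0

  extend-toℕ : ∀ f x → f x ≡ extend f (toℕ x)
  extend-toℕ f x with toℕ x <? n
  ... | yes x<n = cong f (sym (fromℕ<-toℕ x x<n))
  ... | no  x≮n = ⊥-elim (x≮n (toℕ<n x))

  uncolourable : ¬ Colorable H
  uncolourable (f , proper) =
    chain-uncolourable T L (G 0) (G 1) (λ m 1≤m m≤K → coloured (layerEdge m) (1≤m , m≤K))
    (λ m m<K → record
      { link₀₁ = coloured (spokeEdge m s₁₁) m<K ; link₀₂ = coloured (spokeEdge m s₁₂) m<K
      ; link₁₂ = coloured (spokeEdge m s₂₁) m<K ; link₁₀ = coloured (spokeEdge m s₂₂) m<K
      ; link₂₀ = coloured (spokeEdge m s₃₁) m<K ; link₂₁ = coloured (spokeEdge m s₃₂) m<K })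
    (record
      { u₀₁  = coloured (capEdge u₁₂) tt  ; v₁₂  = coloured (capEdge v₂₃) tt
      ; u₀Z₁ = coloured (capEdge u₁K₂) tt ; v₁Z₂ = coloured (capEdge v₂K₃) tt
      ; u₁Z₀ = coloured (capEdge u₂K₁) tt ; v₂Z₁ = coloured (capEdge v₃K₂) tt })
    where
    G : ℕ → ℕ
    G = extend f
    L : ℕ → Triple
    L m = ⟨ G (vertex m 0) , G (vertex m 1) , G (vertex m 2) ⟩
    agree : ∀ m r → r < 3 → G (vertex m r) ≡ at (L m) r
    agree m 0 _ = refl
    agree m 1 _ = refl
    agree m 2 _ = refl
    agree m (suc (suc (suc _))) (s≤s (s≤s (s≤s ())))
    coloured : ∀ D → Valid K D → EdgeColoured (G 0) (G 1) L K D
    coloured D v = subst id (twoColouredOn≡edgeColoured G L agree K D)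
      (Equivalence.to (properOn⇔twoColouredOn 1≤K D v G)
        (properOn-cong (toSubset n (vertices K D)) (extend-toℕ f)
          (subst (ProperOn f) (edge-edgeIndex D v) (proper (edgeIndex D v) ∈⊤))))

  scheme-colouring : ∀ {σ r} d → Fits σ r (odd d) → 1 ≤ d → d ≤ K →
    ∃[ G ] ∀ D → Valid K D → D ≢ removedEdge r d → TwoColouredOn G (vertices K D)
  scheme-colouring {σ} {r} d fits 1≤d d≤K = G , λ D v kept →
    subst id (sym (twoColouredOn≡edgeColoured G L (layered-vertex (colourU σ) (colourV σ) L) K D))
      (scheme-sound d (T + T) fits 1≤d d≤K K-odd D v kept)
    where
    L : ℕ → Triple
    L = layerColour σ d
    G : ℕ → ℕ
    G = layered (colourU σ) (colourV σ) L

  colourable-without : ∀ D → Valid K D → ∃[ G ] ∀ D' → Valid K D' → D' ≢ D → TwoColouredOn G (vertices K D')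
  colourable-without (layerEdge m) (1≤m , m≤K) =
    scheme-colouring m (layerScheme-fits (odd m)) 1≤m m≤K
  colourable-without (spokeEdge m s) m<K =
    scheme-colouring (suc m) (spokeScheme-fits s (odd (suc m))) (s≤s z≤n) m<K
  colourable-without (capEdge c) _ =
    scheme-colouring 1 (capScheme-fits c) ≤-refl 1≤K

  vertex-covered : ∀ m r → r < 3 → m ≤ K → ∃[ D ] Valid K D × vertex m r ∈ vertices K D
  vertex-covered zero    0 _ _ = capEdge u₁₂ , tt , there (here refl)
  vertex-covered zero    1 _ _ = capEdge u₁₂ , tt , there (there (here refl))
  vertex-covered zero    2 _ _ = capEdge v₂₃ , tt , there (there (here refl))
  vertex-covered (suc m) 0 _ m<K = layerEdge (suc m) , (s≤s z≤n , m<K) , here refl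
  vertex-covered (suc m) 1 _ m<K = layerEdge (suc m) , (s≤s z≤n , m<K) , there (here refl)
  vertex-covered (suc m) 2 _ m<K = layerEdge (suc m) , (s≤s z≤n , m<K) , there (there (here refl))
  vertex-covered _ (suc (suc (suc _))) (s≤s (s≤s (s≤s ()))) _

  covered : ∀ x → ∃[ D ] Valid K D × x Subset.∈ toSubset n (vertices K D)
  covered x with toℕ x | toℕ<n x | ∈-toSubset x
  ... | 0 | _ | ∈x = capEdge u₁₂ , tt , ∈x (vertices K (capEdge u₁₂)) (here refl)
  ... | 1 | _ | ∈x = capEdge v₂₃ , tt , ∈x (vertices K (capEdge v₂₃)) (here refl)
  ... | suc (suc z) | s≤s (s≤s z<3K+3) | ∈x
    with D , v , z∈ ← vertex-covered (quot3 z) (rem3 z) (rem3<3 z) (≤-pred (quot3< z<3K+3))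
    = D , v , ∈x (vertices K D) (subst (_∈ vertices K D) (cong (suc ∘ suc) (quot3*3+rem3 z)) z∈)

  minimal : ∀ V' E' → IsSub H V' E' → ¬ (V' ≡ Subset.⊤ × E' ≡ Subset.⊤) → ColorableSub H V' E'
  minimal V' E' sub proper-sub with any? (λ i → ¬? (i ∈? E'))
  ... | yes (i , i∉E') = without-i (lookup-edgeList i)
    where
    without-i : ∃[ D ] Valid K D × lookup (edgeList K) i ≡ vertices K D → ColorableSub H V' E'
    without-i (D , v , i↦D) with G , colours ← colourable-without D v = G ∘ toℕ , proper
      where
      proper : ∀ j → j Subset.∈ E' → ProperOn (G ∘ toℕ) (edge H j)
      proper j j∈E' with D' , v' , j↦D' ← lookup-edgeList j =
        subst (ProperOn (G ∘ toℕ)) (cong (toSubset n) (sym j↦D'))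
          (Equivalence.from (properOn⇔twoColouredOn 1≤K D' v' G) (colours D' v' D'≢D))
        where
        D'≢D : D' ≢ D
        D'≢D refl =
          i∉E' (subst (Subset._∈ E') (lookup-injective edgeList-unique (trans j↦D' (sym i↦D))) j∈E')
  ... | no nothing-removed = ⊥-elim (proper-sub (⊆-antisym ⊆⊤ all∈V' , ⊆-antisym ⊆⊤ (λ {i} _ → all∈E' i)))
    where
    all∈E' : ∀ i → i Subset.∈ E'
    all∈E' i with i ∈? E'
    ... | yes i∈E' = i∈E'
    ... | no  i∉E' = ⊥-elim (nothing-removed (i , i∉E'))
    all∈V' : Subset.⊤ ⊆ V'
    all∈V' {x} _ with D , v , x∈D ← covered x =
      sub (edgeIndex D v) (all∈E' _) (subst (x Subset.∈_) (sym (edge-edgeIndex D v)) x∈D)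

lemma4p5 : ∀ (k : ℕ) → 1 ≤ k → MinimalUncolorable (Hlemma k)
lemma4p5 (suc T) _ = subst (λ K → MinimalUncolorable (fromLists (2 + 3 * K) (HKEdgesNoV1 K ++ newEdges K)))
  (sym (2*[1+t]≡ T)) (Construction.uncolourable T , Construction.minimal T)
  where
  2*[1+t]≡ : ∀ t → 2 * suc t ≡ suc (suc (t + t))
  2*[1+t]≡ t = cong suc (trans (+-suc t (t + 0)) (cong (suc ∘ (t +_)) (+-identityʳ t)))
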